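{- Let $T_n$ be the tree with $4n-2$ vertices obtained from the path with vertices $v_1,\dots,v_{3n-2}$ (edges $v_jv_{j+1}$) by adding vertices $w_1,\dots,w_n$, where $w_i$ is adjacent only to $v_{3i-2}$. Then $\lim_{n\to\infty}\mathcal{I}(T_n)=\frac{13}{18}$.
   Context: For a finite simple graph $G$: a matching is a set of pairwise vertex-disjoint edges; it is maximal if not contained in a larger matching. $\nu(G)$ is the maximum matching size, $\mathcal{T}_0(G)$ the number of maximal matchings, $\mathcal{T}_1(G)$ the sum of the sizes of all maximal matchings, and $\mathcal{I}(G)=\frac{\mathcal{T}_1(G)}{\nu(G)\mathcal{T}_0(G)}$ (equal to $1$ by convention if $\nu(G)=0$). -}

module Defs where

open import Data.Bool using (Bool; true; false; _∧_; not; if_then_else_)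
open import Data.Nat using (ℕ; zero; suc; _+_; _*_; _∸_; _⊔_; _≡ᵇ_)
open import Data.Product using (_×_; _,_)
open import Data.List using (List; []; _∷_; _++_; map; filter; length; sum; foldr; all; any; upTo; applyUpTo)
open import Data.Integer using (+_)
open import Data.Rational using (ℚ; _/_; 1ℚ)

-- An edge is an (unordered, represented by an ordered) pair of vertex labels.
Edge : Set
Edge = ℕ × ℕ

-- all Boolean choice vectors (lists) of length k: these encode the subsets
-- of an edge list of length k
choices : ℕ → List (List Bool)
choices zero = [] ∷ []
choices (suc k) = map (true ∷_) (choices k) ++ map (false ∷_) (choices k)

sel : List Edge → List Bool → List Edge
sel [] _ = []
sel (e ∷ es) [] = []
sel (e ∷ es) (true ∷ bs) = e ∷ sel es bs
sel (e ∷ es) (false ∷ bs) = sel es bs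

_≠ᵇ_ : ℕ → ℕ → Bool
a ≠ᵇ b = not (a ≡ᵇ b)

disjointᵇ : Edge → Edge → Bool
disjointᵇ (a , b) (c , d) = (a ≠ᵇ c) ∧ (a ≠ᵇ d) ∧ (b ≠ᵇ c) ∧ (b ≠ᵇ d)

isMatchingᵇ : List Edge → Bool
isMatchingᵇ [] = true
isMatchingᵇ (e ∷ es) = all (disjointᵇ e) es ∧ isMatchingᵇ es

_⊆ᵇ_ : List Bool → List Bool → Bool
[] ⊆ᵇ _ = true
(b ∷ bs) ⊆ᵇ [] = not b ∧ ([] ⊆ᵇ bs)
(true ∷ bs) ⊆ᵇ (c ∷ cs) = c ∧ (bs ⊆ᵇ cs)
(false ∷ bs) ⊆ᵇ (c ∷ cs) = bs ⊆ᵇ cs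

_≟ᵇs_ : List Bool → List Bool → Bool
[] ≟ᵇs [] = true
(true ∷ bs) ≟ᵇs (true ∷ cs) = bs ≟ᵇs cs
(false ∷ bs) ≟ᵇs (false ∷ cs) = bs ≟ᵇs cs
_ ≟ᵇs _ = false

-- Graph given by its edge list E (a simple graph: distinct non-loop edges).
-- Subsets of E are the choice vectors of length (length E).
subsetsOf : List Edge → List (List Bool)
subsetsOf E = choices (length E)

isMatching : List Edge → List Bool → Bool
isMatching E c = isMatchingᵇ (sel E c)

isMaximalMatching : List Edge → List Bool → Bool
isMaximalMatching E c =
  isMatching E c ∧
  not (any (λ c' → isMatching E c' ∧ (c ⊆ᵇ c') ∧ not (c ≟ᵇs c')) (subsetsOf E))

size : List Edge → List Bool → ℕ
size E c = length (sel E c)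

ν : List Edge → ℕ
ν E = foldr _⊔_ 0 (map (size E) (filter (λ c → isMatching E c Data.Bool.≟ true) (subsetsOf E)))
  where import Data.Bool

maximalMatchings : List Edge → List (List Bool)
maximalMatchings E = filter (λ c → isMaximalMatching E c Data.Bool.≟ true) (subsetsOf E)
  where import Data.Bool

𝒯₀ : List Edge → ℕ
𝒯₀ E = length (maximalMatchings E)

𝒯₁ : List Edge → ℕ
𝒯₁ E = sum (map (size E) (maximalMatchings E))

-- ℐ(G) = 𝒯₁ / (ν 𝒯₀), and 1 by convention if ν = 0
-- (𝒯₀ ≥ 1 always, so the denominator is zero exactly when ν = 0)
ℐ : List Edge → ℚ
ℐ E with ν E * 𝒯₀ E
... | zero = 1ℚ
... | suc d = (+ 𝒯₁ E) / suc d

-- The tree T_n: path v_1 … v_{3n-2} (vertex v_j labelled j) plus pendant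
-- vertices w_1 … w_n (w_i labelled 3n-2+i), w_i adjacent only to v_{3i-2}.
T : ℕ → List Edge
T n = applyUpTo (λ k → (suc k , suc (suc k))) (3 * n ∸ 3)
   ++ applyUpTo (λ k → (3 * suc k ∸ 2 , (3 * n ∸ 2) + suc k)) n

-- Cut T_{j+1} into j blocks, each made of three consecutive path edges and the pendant edge at the
-- block's first vertex, followed by one last pendant edge. Whether a choice of edges is a maximal
-- matching can be decided block by block: a block only needs to know whether its first vertex is
-- covered by the previous block and whether its last vertex is covered by the next one, and after
-- relabelling a block to a standard position that local condition is a Boolean function of four bits,
-- checked by its truth table. Hence the maximal matchings are counted by the transfer matrix
-- [[2, 2], [1, 1]], and their total size obeys a similar linear recursion. For j ≥ 2 this gives
-- 𝒯₀ = A and 9 𝒯₁ = A (13 j + 7) for some A > 0, while ν = 2 j + 1 (every block contributes at most two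
-- edges, and alternating matchings attain this). So ℐ(T_{j+1}) = (13 j + 7) / (9 (2 j + 1)), which differs
-- from 13/18 by exactly 1 / (18 (2 j + 1)).

module Submission where

open import Defs
open import Algebra.Bundles using (CommutativeMonoid)
open import Algebra.Properties.CommutativeSemigroup as CommutativeSemigroupProperties using ()
open import Data.Bool using (Bool; true; false; _∧_; _∨_; not; _xor_)
open import Data.Bool.Properties
  using (_≟_; ∧-assoc; ∨-assoc; ∧-zeroʳ; ∨-zeroʳ; ∨-identityʳ; ∧-identityʳ; ∧-conicalˡ; ∧-conicalʳ; not-injective;
         ∧-commutativeMonoid; ∨-commutativeMonoid)
open import Data.Integer as ℤ using (+_; -[1+_]; +<+)
open import Data.Integer.Properties using (pos-*; pos-+)
import Data.Integer.Solver as ℤ-Solver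
open import Data.List using (List; []; _∷_; _++_; map; length; all; any; filter; sum; foldr; replicate; applyUpTo)
open import Data.List.Properties using (++-assoc; length-++; map-++; map-∘; length-replicate)
open import Data.List.Relation.Unary.All using (All; []; _∷_)
open import Data.List.Relation.Unary.All.Properties using (++⁺)
open import Data.Nat using (ℕ; zero; suc; _+_; _*_; _∸_; _⊔_; _≡ᵇ_; _≤_; _≤?_; s≤s; z≤n) renaming (_<_ to _<ₙ_)
open import Data.Nat.Coprimality using (Coprime)
open import Data.Nat.ListAction.Properties using (sum-++)
open import Data.Nat.Properties
  using (suc-injective; +-comm; +-assoc; +-suc; +-identityʳ; *-suc; *-comm; *-distribˡ-+; *-distribʳ-+;
         +-commutativeSemigroup; ⊔-assoc; ⊔-identityʳ; ⊔-lub; m≤m⊔n; m≤n⊔m;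
         ≤-refl; ≤-reflexive; ≤-trans; ≤-antisym; ≤-<-trans; <-≤-trans; <-trans; ≤-pred; n≤1+n; n<1+n;
         m≤n⇒m≤1+n; m<n⇒m<1+n; m≤m+n; m≤n+m; m+[n∸m]≡n; m∸n≤m; +-mono-≤; +-monoˡ-≤; +-monoʳ-≤; +-monoˡ-<;
         *-monoʳ-≤; m<m*n; m≤n*m)
import Data.Nat.Solver as ℕ-Solver
open import Data.Product using (Σ; _×_; _,_; proj₁; proj₂)
open import Data.Rational using (ℚ; mkℚ; _/_; _-_; -_; ∣_∣; _<_; 0ℚ; toℚᵘ; *<*)
open import Data.Rational.Properties using (toℚᵘ-cancel-<; toℚᵘ-homo-∣-∣; toℚᵘ-homo-+; toℚᵘ-fromℚᵘ; toℚᵘ-homo‿-)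
open import Data.Rational.Unnormalised as ℚᵘ using (mkℚᵘ; _≃_)
open import Data.Rational.Unnormalised.Properties using (<-respˡ-≃; ≃-sym; ≃-trans; ∣-∣-cong; +-cong; -‿cong)
open import Data.Sum using (_⊎_; inj₁; inj₂)
open import Function using (_∘_)
open import Relation.Binary.PropositionalEquality
open import Relation.Nullary using (contradiction)
open import Relation.Nullary.Decidable using (Dec; True; toWitness; from-yes; map′; _×-dec_; _→-dec_)

open CommutativeSemigroupProperties (CommutativeMonoid.commutativeSemigroup ∧-commutativeMonoid)
  using (interchange; x∙yz≈y∙xz)
open CommutativeSemigroupProperties (CommutativeMonoid.commutativeSemigroup ∨-commutativeMonoid)
  using (xy∙z≈x∙zy; xy∙z≈y∙zx)
open CommutativeSemigroupProperties +-commutativeSemigroup using () renaming (interchange to +-interchange)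

BoolFun : ℕ → Set
BoolFun zero = Bool
BoolFun (suc n) = Bool → BoolFun n

_≗ᵇ_ : ∀ {n} → BoolFun n → BoolFun n → Set
_≗ᵇ_ {zero} f g = f ≡ g
_≗ᵇ_ {suc n} f g = ∀ b → f b ≗ᵇ g b

∀ᵇ? : {P : Bool → Set} → ((b : Bool) → Dec (P b)) → Dec ((b : Bool) → P b)
∀ᵇ? P? = map′ (λ (t , f) → λ { true → t ; false → f }) (λ P → P true , P false) (P? true ×-dec P? false)

_≟ᵇ_ : ∀ {n} (f g : BoolFun n) → Dec (f ≗ᵇ g)
_≟ᵇ_ {zero} f g = f ≟ g
_≟ᵇ_ {suc n} f g = ∀ᵇ? λ b → f b ≟ᵇ g b

-- f and g are found by unifying the goal with f b₁ … bₙ ≡ g b₁ … bₙ, so the bᵢ must be variables.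
truth-table : ∀ n {f g : BoolFun n} {ok : True (f ≟ᵇ g)} → f ≗ᵇ g
truth-table n {ok = ok} = toWitness ok

all-++ : ∀ {A : Set} (P : A → Bool) xs ys → all P (xs ++ ys) ≡ (all P xs ∧ all P ys)
all-++ P [] ys = refl
all-++ P (x ∷ xs) ys = trans (cong (P x ∧_) (all-++ P xs ys)) (sym (∧-assoc (P x) _ _))

any-++ : ∀ {A : Set} (P : A → Bool) xs ys → any P (xs ++ ys) ≡ (any P xs ∨ any P ys)
any-++ P [] ys = refl
any-++ P (x ∷ xs) ys = trans (cong (P x ∨_) (any-++ P xs ys)) (sym (∨-assoc (P x) _ _))

all-∧ : ∀ {A : Set} (P Q : A → Bool) xs → all (λ x → P x ∧ Q x) xs ≡ (all P xs ∧ all Q xs)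
all-∧ P Q [] = refl
all-∧ P Q (x ∷ xs) = trans (cong ((P x ∧ Q x) ∧_) (all-∧ P Q xs)) (interchange (P x) (Q x) _ _)

all-const-true : ∀ {A : Set} (xs : List A) → all (λ _ → true) xs ≡ true
all-const-true [] = refl
all-const-true (x ∷ xs) = all-const-true xs

all-all-comm : ∀ {A B : Set} (R : A → B → Bool) xs ys →
  all (λ x → all (R x) ys) xs ≡ all (λ y → all (λ x → R x y) xs) ys
all-all-comm R [] ys = sym (all-const-true ys)
all-all-comm R (x ∷ xs) ys =
  trans (cong (all (R x) ys ∧_) (all-all-comm R xs ys)) (sym (all-∧ (R x) _ ys))

all-cong : ∀ {A : Set} {P Q : A → Bool} → P ≗ Q → ∀ xs → all P xs ≡ all Q xs
all-cong P≗Q [] = refl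
all-cong P≗Q (x ∷ xs) = cong₂ _∧_ (P≗Q x) (all-cong P≗Q xs)

any-map : ∀ {A B : Set} (P : B → Bool) (f : A → B) xs → any P (map f xs) ≡ any (P ∘ f) xs
any-map P f [] = refl
any-map P f (x ∷ xs) = cong (P (f x) ∨_) (any-map P f xs)

any-choices-suc : ∀ k (P : List Bool → Bool) →
  any P (choices (suc k)) ≡ (any (P ∘ (true ∷_)) (choices k) ∨ any (P ∘ (false ∷_)) (choices k))
any-choices-suc k P =
  trans (any-++ P (map (true ∷_) (choices k)) (map (false ∷_) (choices k)))
        (cong₂ _∨_ (any-map P (true ∷_) (choices k)) (any-map P (false ∷_) (choices k)))

any-choices-intro : ∀ (P : List Bool → Bool) c → P c ≡ true → any P (choices (length c)) ≡ true
any-choices-intro P [] Pc = cong (_∨ false) Pc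
any-choices-intro P (true ∷ c) Pc =
  trans (any-choices-suc (length c) P)
        (cong (_∨ any (P ∘ (false ∷_)) (choices (length c))) (any-choices-intro (P ∘ (true ∷_)) c Pc))
any-choices-intro P (false ∷ c) Pc =
  trans (any-choices-suc (length c) P)
        (trans (cong (any (P ∘ (true ∷_)) (choices (length c)) ∨_) (any-choices-intro (P ∘ (false ∷_)) c Pc))
               (∨-zeroʳ _))

any-choices-elim : ∀ k (P : List Bool → Bool) → any P (choices k) ≡ true →
  Σ (List Bool) λ c → length c ≡ k × P c ≡ true
any-choices-elim zero P h = [] , refl , trans (sym (∨-identityʳ (P []))) h
any-choices-elim (suc k) P h
  with any (P ∘ (true ∷_)) (choices k) in e | trans (sym (any-choices-suc k P)) h
... | true | _ = let (c , l , Pc) = any-choices-elim k (P ∘ (true ∷_)) e in true ∷ c , cong suc l , Pc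
... | false | h′ = let (c , l , Pc) = any-choices-elim k (P ∘ (false ∷_)) h′ in false ∷ c , cong suc l , Pc

touches : ℕ → Edge → Bool
touches v (a , b) = (v ≡ᵇ a) ∨ (v ≡ᵇ b)

covers : List Edge → ℕ → Bool
covers M v = any (touches v) M

meets : (ℕ → Bool) → Edge → Bool
meets g (a , b) = g a ∨ g b

avoids : (ℕ → Bool) → Edge → Bool
avoids g e = not (meets g e)

∅ : ℕ → Bool
∅ _ = false

_∪_ : (ℕ → Bool) → (ℕ → Bool) → ℕ → Bool
(g ∪ h) v = g v ∨ h v

isMatchingAvoiding : List Edge → (ℕ → Bool) → Bool
isMatchingAvoiding M h = isMatchingᵇ M ∧ all (avoids h) M

dominated : List Edge → List Bool → (ℕ → Bool) → Bool
dominated [] _ g = true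
dominated (e ∷ E) [] g = true
dominated (e ∷ E) (true ∷ c) g = dominated E c g
dominated (e ∷ E) (false ∷ c) g = meets g e ∧ dominated E c g

-- sel E c is a maximal matching of the graph obtained from E by deleting the vertices in h.
isMaximalMatchingAvoiding : List Edge → List Bool → (ℕ → Bool) → Bool
isMaximalMatchingAvoiding E c h =
  isMatchingAvoiding (sel E c) h ∧ dominated E c (covers (sel E c) ∪ h)

≡ᵇ-sym : ∀ m n → (m ≡ᵇ n) ≡ (n ≡ᵇ m)
≡ᵇ-sym zero zero = refl
≡ᵇ-sym zero (suc n) = refl
≡ᵇ-sym (suc m) zero = refl
≡ᵇ-sym (suc m) (suc n) = ≡ᵇ-sym m n

≡ᵇ-refl : ∀ n → (n ≡ᵇ n) ≡ true
≡ᵇ-refl zero = refl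
≡ᵇ-refl (suc n) = ≡ᵇ-refl n

+-≡ᵇ : ∀ s m n → (s + m ≡ᵇ s + n) ≡ (m ≡ᵇ n)
+-≡ᵇ zero m n = refl
+-≡ᵇ (suc s) m n = +-≡ᵇ s m n

<⇒≡ᵇ-false : ∀ {m n} → m <ₙ n → (m ≡ᵇ n) ≡ false
<⇒≡ᵇ-false {zero} (s≤s _) = refl
<⇒≡ᵇ-false {suc m} (s≤s m<n@(s≤s _)) = <⇒≡ᵇ-false m<n

>⇒≡ᵇ-false : ∀ {m n} → n <ₙ m → (m ≡ᵇ n) ≡ false
>⇒≡ᵇ-false {m} {n} n<m = trans (≡ᵇ-sym m n) (<⇒≡ᵇ-false n<m)

disjointᵇ-comm : ∀ e f → disjointᵇ e f ≡ disjointᵇ f e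
disjointᵇ-comm (a , b) (c , d)
  rewrite ≡ᵇ-sym c a | ≡ᵇ-sym c b | ≡ᵇ-sym d a | ≡ᵇ-sym d b =
  cong (not (a ≡ᵇ c) ∧_) (x∙yz≈y∙xz (not (a ≡ᵇ d)) (not (b ≡ᵇ c)) (not (b ≡ᵇ d)))

all-disjointᵇ : ∀ e M → all (disjointᵇ e) M ≡ avoids (covers M) e
all-disjointᵇ (a , b) [] = refl
all-disjointᵇ (a , b) ((c , d) ∷ M) =
  trans (cong (disjointᵇ (a , b) (c , d) ∧_) (all-disjointᵇ (a , b) M))
        (de-morgan (a ≡ᵇ c) (a ≡ᵇ d) (b ≡ᵇ c) (b ≡ᵇ d) (covers M a) (covers M b))
  where
  de-morgan : ∀ p q r s u w →
    (not p ∧ not q ∧ not r ∧ not s) ∧ not (u ∨ w) ≡ not (((p ∨ q) ∨ u) ∨ ((r ∨ s) ∨ w))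
  de-morgan = truth-table 6

all-avoids-∪ : ∀ g h M → all (avoids (g ∪ h)) M ≡ (all (avoids g) M ∧ all (avoids h) M)
all-avoids-∪ g h M =
  trans (all-cong (λ { (a , b) → avoids-∪ (g a) (h a) (g b) (h b) }) M) (all-∧ (avoids g) (avoids h) M)
  where
  avoids-∪ : ∀ p q r s → not ((p ∨ q) ∨ (r ∨ s)) ≡ not (p ∨ r) ∧ not (q ∨ s)
  avoids-∪ = truth-table 4

all-avoids-covers-comm : ∀ A B → all (avoids (covers B)) A ≡ all (avoids (covers A)) B
all-avoids-covers-comm A B = begin
  all (avoids (covers B)) A                          ≡⟨ all-cong (λ a → all-disjointᵇ a B) A ⟨
  all (λ a → all (disjointᵇ a) B) A                  ≡⟨ all-all-comm disjointᵇ A B ⟩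
  all (λ b → all (λ a → disjointᵇ a b) A) B          ≡⟨ all-cong (λ b → all-cong (λ a → disjointᵇ-comm a b) A) B ⟩
  all (λ b → all (disjointᵇ b) A) B                  ≡⟨ all-cong (λ b → all-disjointᵇ b A) B ⟩
  all (avoids (covers A)) B                          ∎
  where open ≡-Reasoning

isMatching-++ : ∀ A B →
  isMatchingᵇ (A ++ B) ≡ ((isMatchingᵇ A ∧ all (avoids (covers B)) A) ∧ isMatchingᵇ B)
isMatching-++ [] B = refl
isMatching-++ (e ∷ A) B = begin
  all (disjointᵇ e) (A ++ B) ∧ isMatchingᵇ (A ++ B)
    ≡⟨ cong₂ _∧_ (all-++ (disjointᵇ e) A B) (isMatching-++ A B) ⟩
  (all (disjointᵇ e) A ∧ all (disjointᵇ e) B) ∧ ((isMatchingᵇ A ∧ all (avoids (covers B)) A) ∧ isMatchingᵇ B)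
    ≡⟨ cong (λ z → (all (disjointᵇ e) A ∧ z) ∧ _) (all-disjointᵇ e B) ⟩
  (all (disjointᵇ e) A ∧ avoids (covers B) e) ∧ ((isMatchingᵇ A ∧ all (avoids (covers B)) A) ∧ isMatchingᵇ B)
    ≡⟨ regroup (all (disjointᵇ e) A) (avoids (covers B) e) (isMatchingᵇ A) (all (avoids (covers B)) A) (isMatchingᵇ B) ⟩
  ((all (disjointᵇ e) A ∧ isMatchingᵇ A) ∧ (avoids (covers B) e ∧ all (avoids (covers B)) A)) ∧ isMatchingᵇ B
    ∎
  where
  open ≡-Reasoning
  regroup : ∀ p q i x r → (p ∧ q) ∧ ((i ∧ x) ∧ r) ≡ ((p ∧ i) ∧ (q ∧ x)) ∧ r
  regroup = truth-table 5

isMatchingAvoiding-++ : ∀ A B h →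
  isMatchingAvoiding (A ++ B) h ≡
  (isMatchingAvoiding A (h ∪ covers B) ∧ isMatchingAvoiding B (h ∪ covers A))
isMatchingAvoiding-++ A B h = begin
  isMatchingᵇ (A ++ B) ∧ all (avoids h) (A ++ B)
    ≡⟨ cong₂ _∧_ (isMatching-++ A B) (all-++ (avoids h) A B) ⟩
  ((iA ∧ X) ∧ iB) ∧ (hA ∧ hB)
    ≡⟨ regroup iA X iB hA hB ⟩
  (iA ∧ (hA ∧ X)) ∧ (iB ∧ (hB ∧ X))
    ≡⟨ cong₂ (λ u w → (iA ∧ u) ∧ (iB ∧ w))
             (sym (all-avoids-∪ h (covers B) A))
             (trans (cong (hB ∧_) (all-avoids-covers-comm A B)) (sym (all-avoids-∪ h (covers A) B))) ⟩
  isMatchingAvoiding A (h ∪ covers B) ∧ isMatchingAvoiding B (h ∪ covers A)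
    ∎
  where
  open ≡-Reasoning
  iA iB hA hB X : Bool
  iA = isMatchingᵇ A
  iB = isMatchingᵇ B
  hA = all (avoids h) A
  hB = all (avoids h) B
  X = all (avoids (covers B)) A
  regroup : ∀ iA X iB hA hB → ((iA ∧ X) ∧ iB) ∧ (hA ∧ hB) ≡ (iA ∧ (hA ∧ X)) ∧ (iB ∧ (hB ∧ X))
  regroup = truth-table 5

⊆ᵇ-refl : ∀ c → (c ⊆ᵇ c) ≡ true
⊆ᵇ-refl [] = refl
⊆ᵇ-refl (true ∷ c) = ⊆ᵇ-refl c
⊆ᵇ-refl (false ∷ c) = ⊆ᵇ-refl c

all-sel-⊆ᵇ : ∀ (P : Edge → Bool) E c c′ → length c ≡ length c′ → (c ⊆ᵇ c′) ≡ true →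
  all P (sel E c′) ≡ true → all P (sel E c) ≡ true
all-sel-⊆ᵇ P [] c c′ _ _ _ = refl
all-sel-⊆ᵇ P (e ∷ E) [] c′ _ _ _ = refl
all-sel-⊆ᵇ P (e ∷ E) (true ∷ c) (true ∷ c′) l c⊆c′ h =
  cong₂ _∧_ (∧-conicalˡ (P e) _ h) (all-sel-⊆ᵇ P E c c′ (suc-injective l) c⊆c′ (∧-conicalʳ (P e) _ h))
all-sel-⊆ᵇ P (e ∷ E) (false ∷ c) (true ∷ c′) l c⊆c′ h =
  all-sel-⊆ᵇ P E c c′ (suc-injective l) c⊆c′ (∧-conicalʳ (P e) _ h)
all-sel-⊆ᵇ P (e ∷ E) (false ∷ c) (false ∷ c′) l c⊆c′ h = all-sel-⊆ᵇ P E c c′ (suc-injective l) c⊆c′ h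

isMatching-insert : ∀ Z e W →
  isMatchingᵇ (Z ++ e ∷ W) ≡ (all (disjointᵇ e) (Z ++ W) ∧ isMatchingᵇ (Z ++ W))
isMatching-insert [] e W = refl
isMatching-insert (z ∷ Z) e W
  rewrite all-++ (disjointᵇ z) Z (e ∷ W) | isMatching-insert Z e W | disjointᵇ-comm z e | all-++ (disjointᵇ z) Z W =
  regroup (all (disjointᵇ z) Z) (disjointᵇ e z) (all (disjointᵇ z) W) (all (disjointᵇ e) (Z ++ W)) (isMatchingᵇ (Z ++ W))
  where
  regroup : ∀ a d b c m → (a ∧ d ∧ b) ∧ (c ∧ m) ≡ (d ∧ c) ∧ ((a ∧ b) ∧ m)
  regroup = truth-table 5

disjointFromAll : List Edge → List Edge → Bool
disjointFromAll L Z = all (λ l → all (disjointᵇ l) Z) L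

disjointFromAll-[] : ∀ L → disjointFromAll L [] ≡ true
disjointFromAll-[] [] = refl
disjointFromAll-[] (l ∷ L) = disjointFromAll-[] L

disjointFromAll-snoc : ∀ L Z e → disjointFromAll L Z ≡ true → all (disjointᵇ e) L ≡ true →
  disjointFromAll L (Z ++ e ∷ []) ≡ true
disjointFromAll-snoc [] Z e _ _ = refl
disjointFromAll-snoc (l ∷ L) Z e hZ he
  rewrite all-++ (disjointᵇ l) Z (e ∷ []) | ∧-conicalˡ (all (disjointᵇ l) Z) _ hZ
        | disjointᵇ-comm l e | ∧-conicalˡ (disjointᵇ e l) _ he =
  disjointFromAll-snoc L Z e (∧-conicalʳ (all (disjointᵇ l) Z) _ hZ) (∧-conicalʳ (disjointᵇ e l) _ he)

meets-false : ∀ g e → avoids g e ≡ true → meets g e ≡ false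
meets-false g e h with meets g e
meets-false g e () | true
... | false = refl

-- Z collects the already processed edges selected by c; they are selected by c′ as well.
properExtension⇒undominated : ∀ E c c′ Z → length c ≡ length E → length c ≡ length c′ →
  isMatchingᵇ (sel E c′) ≡ true → (c ⊆ᵇ c′) ≡ true → (c ≟ᵇs c′) ≡ false →
  disjointFromAll (sel E c′) Z ≡ true → dominated E c (covers (Z ++ sel E c)) ≡ false
properExtension⇒undominated [] [] [] Z _ _ _ _ () _
properExtension⇒undominated (e ∷ E) (true ∷ c) (true ∷ c′) Z l l′ m c⊆c′ c≠c′ d =
  subst (λ W → dominated E c (covers W) ≡ false) (++-assoc Z (e ∷ []) (sel E c))
    (properExtension⇒undominated E c c′ (Z ++ e ∷ []) (suc-injective l) (suc-injective l′)
      (∧-conicalʳ (all (disjointᵇ e) (sel E c′)) _ m) c⊆c′ c≠c′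
      (disjointFromAll-snoc (sel E c′) Z e (∧-conicalʳ (all (disjointᵇ e) Z) _ d)
                            (∧-conicalˡ (all (disjointᵇ e) (sel E c′)) _ m)))
properExtension⇒undominated (e ∷ E) (false ∷ c) (true ∷ c′) Z l l′ m c⊆c′ c≠c′ d =
  cong (_∧ dominated E c (covers (Z ++ sel E c))) (meets-false (covers (Z ++ sel E c)) e (begin
    avoids (covers (Z ++ sel E c)) e          ≡⟨ all-disjointᵇ e (Z ++ sel E c) ⟨
    all (disjointᵇ e) (Z ++ sel E c)          ≡⟨ all-++ (disjointᵇ e) Z (sel E c) ⟩
    all (disjointᵇ e) Z ∧ all (disjointᵇ e) (sel E c)
      ≡⟨ cong₂ _∧_ (∧-conicalˡ (all (disjointᵇ e) Z) _ d)
                   (all-sel-⊆ᵇ (disjointᵇ e) E c c′ (suc-injective l′) c⊆c′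
                      (∧-conicalˡ (all (disjointᵇ e) (sel E c′)) _ m)) ⟩
    true                                      ∎))
  where open ≡-Reasoning
properExtension⇒undominated (e ∷ E) (false ∷ c) (false ∷ c′) Z l l′ m c⊆c′ c≠c′ d =
  trans (cong (meets (covers (Z ++ sel E c)) e ∧_)
              (properExtension⇒undominated E c c′ Z (suc-injective l) (suc-injective l′) m c⊆c′ c≠c′ d))
        (∧-zeroʳ _)

undominated⇒properExtension : ∀ E c Z → length c ≡ length E →
  isMatchingᵇ (Z ++ sel E c) ≡ true → dominated E c (covers (Z ++ sel E c)) ≡ false →
  Σ (List Bool) λ c′ → length c′ ≡ length c × isMatchingᵇ (Z ++ sel E c′) ≡ true ×
                       (c ⊆ᵇ c′) ≡ true × (c ≟ᵇs c′) ≡ false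
undominated⇒properExtension (e ∷ E) (true ∷ c) Z l m u
  with undominated⇒properExtension E c (Z ++ e ∷ []) (suc-injective l)
         (subst (λ W → isMatchingᵇ W ≡ true) (sym (++-assoc Z (e ∷ []) (sel E c))) m)
         (subst (λ W → dominated E c (covers W) ≡ false) (sym (++-assoc Z (e ∷ []) (sel E c))) u)
... | c′ , l′ , m′ , c⊆c′ , c≠c′ =
  true ∷ c′ , cong suc l′ , subst (λ W → isMatchingᵇ W ≡ true) (++-assoc Z (e ∷ []) (sel E c′)) m′ , c⊆c′ , c≠c′
undominated⇒properExtension (e ∷ E) (false ∷ c) Z l m u
  with dominated E c (covers (Z ++ sel E c)) in u′
... | false =
  let c′ , l′ , m′ , c⊆c′ , c≠c′ = undominated⇒properExtension E c Z (suc-injective l) m u′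
  in false ∷ c′ , cong suc l′ , m′ , c⊆c′ , c≠c′
... | true =
  true ∷ c , refl ,
  trans (isMatching-insert Z e (sel E c))
        (cong₂ _∧_ (trans (all-disjointᵇ e (Z ++ sel E c)) (cong not (trans (sym (∧-identityʳ _)) u))) m) ,
  ⊆ᵇ-refl c , refl

properlyExtends : List Edge → List Bool → List Bool → Bool
properlyExtends E c c′ = isMatching E c′ ∧ (c ⊆ᵇ c′) ∧ not (c ≟ᵇs c′)

isMaximalMatching≡dominated : ∀ E c → length c ≡ length E →
  isMaximalMatching E c ≡ (isMatching E c ∧ dominated E c (covers (sel E c)))
isMaximalMatching≡dominated E c l with isMatching E c in m
... | false = refl
... | true with dominated E c (covers (sel E c)) in d
...   | false =
  let c′ , l′ , m′ , c⊆c′ , c≠c′ = undominated⇒properExtension E c [] l m d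
  in cong not (subst (λ k → any (properlyExtends E c) (choices k) ≡ true) (trans l′ l)
                 (any-choices-intro (properlyExtends E c) c′ (cong₂ _∧_ m′ (cong₂ _∧_ c⊆c′ (cong not c≠c′)))))
...   | true with any (properlyExtends E c) (subsetsOf E) in a
...     | false = refl
...     | true =
  let c′ , l′ , p = any-choices-elim (length E) (properlyExtends E c) a
      c⊆≠c′ = ∧-conicalʳ (isMatching E c′) _ p
  in contradiction (trans (sym d)
       (properExtension⇒undominated E c c′ [] l (trans l (sym l′)) (∧-conicalˡ (isMatching E c′) _ p)
          (∧-conicalˡ (c ⊆ᵇ c′) _ c⊆≠c′) (not-injective (∧-conicalʳ (c ⊆ᵇ c′) _ c⊆≠c′))
          (disjointFromAll-[] (sel E c′))))
       λ ()

AgreeOn : List Edge → (ℕ → Bool) → (ℕ → Bool) → Set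
AgreeOn E g h = All (λ (a , b) → g a ≡ h a × g b ≡ h b) E

≗⇒AgreeOn : ∀ {g h} → g ≗ h → ∀ E → AgreeOn E g h
≗⇒AgreeOn g≗h [] = []
≗⇒AgreeOn g≗h ((a , b) ∷ E) = (g≗h a , g≗h b) ∷ ≗⇒AgreeOn g≗h E

AgreeOn-sel : ∀ {g h} E c → AgreeOn E g h → AgreeOn (sel E c) g h
AgreeOn-sel [] c agree = []
AgreeOn-sel (e ∷ E) [] agree = []
AgreeOn-sel (e ∷ E) (true ∷ c) (ae ∷ agree) = ae ∷ AgreeOn-sel E c agree
AgreeOn-sel (e ∷ E) (false ∷ c) (ae ∷ agree) = AgreeOn-sel E c agree

AgreeOn-∪ˡ : ∀ {g h} F E → AgreeOn E g h → AgreeOn E (F ∪ g) (F ∪ h)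
AgreeOn-∪ˡ F [] [] = []
AgreeOn-∪ˡ F ((a , b) ∷ E) ((ga , gb) ∷ agree) = (cong (F a ∨_) ga , cong (F b ∨_) gb) ∷ AgreeOn-∪ˡ F E agree

isMatchingAvoiding-cong : ∀ {g h} M → AgreeOn M g h → isMatchingAvoiding M g ≡ isMatchingAvoiding M h
isMatchingAvoiding-cong M agree = cong (isMatchingᵇ M ∧_) (all-avoids M agree)
  where
  all-avoids : ∀ {g h} M → AgreeOn M g h → all (avoids g) M ≡ all (avoids h) M
  all-avoids [] [] = refl
  all-avoids ((a , b) ∷ M) ((ga , gb) ∷ agree) = cong₂ _∧_ (cong not (cong₂ _∨_ ga gb)) (all-avoids M agree)

dominated-cong : ∀ {g h} E c → AgreeOn E g h → dominated E c g ≡ dominated E c h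
dominated-cong [] c agree = refl
dominated-cong (e ∷ E) [] agree = refl
dominated-cong (e ∷ E) (true ∷ c) (ae ∷ agree) = dominated-cong E c agree
dominated-cong ((a , b) ∷ E) (false ∷ c) ((ga , gb) ∷ agree) =
  cong₂ _∧_ (cong₂ _∨_ ga gb) (dominated-cong E c agree)

isMaximalMatchingAvoiding-cong : ∀ {g h} E c → AgreeOn E g h →
  isMaximalMatchingAvoiding E c g ≡ isMaximalMatchingAvoiding E c h
isMaximalMatchingAvoiding-cong E c agree =
  cong₂ _∧_ (isMatchingAvoiding-cong (sel E c) (AgreeOn-sel E c agree))
            (dominated-cong E c (AgreeOn-∪ˡ (covers (sel E c)) E agree))

isMatching≡Avoiding∅ : ∀ M → isMatchingᵇ M ≡ isMatchingAvoiding M ∅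
isMatching≡Avoiding∅ M = sym (trans (cong (isMatchingᵇ M ∧_) (all-avoids-∅ M)) (∧-identityʳ _))
  where
  all-avoids-∅ : ∀ M → all (avoids ∅) M ≡ true
  all-avoids-∅ [] = refl
  all-avoids-∅ ((a , b) ∷ M) = all-avoids-∅ M

isMaximalMatching≡Avoiding∅ : ∀ E c → length c ≡ length E →
  isMaximalMatching E c ≡ isMaximalMatchingAvoiding E c ∅
isMaximalMatching≡Avoiding∅ E c l =
  trans (isMaximalMatching≡dominated E c l)
        (cong₂ _∧_ (isMatching≡Avoiding∅ (sel E c))
                   (dominated-cong E c (≗⇒AgreeOn (λ v → sym (∨-identityʳ _)) E)))

sel-++ : ∀ A B a b → length a ≡ length A → sel (A ++ B) (a ++ b) ≡ sel A a ++ sel B b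
sel-++ [] B [] b l = refl
sel-++ (e ∷ A) B (true ∷ a) b l = cong (e ∷_) (sel-++ A B a b (suc-injective l))
sel-++ (e ∷ A) B (false ∷ a) b l = sel-++ A B a b (suc-injective l)

dominated-++ : ∀ A B a b g → length a ≡ length A →
  dominated (A ++ B) (a ++ b) g ≡ (dominated A a g ∧ dominated B b g)
dominated-++ [] B [] b g l = refl
dominated-++ (e ∷ A) B (true ∷ a) b g l = dominated-++ A B a b g (suc-injective l)
dominated-++ (e ∷ A) B (false ∷ a) b g l =
  trans (cong (meets g e ∧_) (dominated-++ A B a b g (suc-injective l))) (sym (∧-assoc (meets g e) _ _))

covers-sel-++ : ∀ A B a b → length a ≡ length A →
  covers (sel (A ++ B) (a ++ b)) ≗ (covers (sel A a) ∪ covers (sel B b))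
covers-sel-++ A B a b l v = trans (cong (λ M → covers M v) (sel-++ A B a b l)) (any-++ (touches v) (sel A a) (sel B b))

isMaximalMatchingAvoiding-++ : ∀ A B a b h → length a ≡ length A →
  isMaximalMatchingAvoiding (A ++ B) (a ++ b) h ≡
  (isMaximalMatchingAvoiding A a (h ∪ covers (sel B b)) ∧ isMaximalMatchingAvoiding B b (h ∪ covers (sel A a)))
isMaximalMatchingAvoiding-++ A B a b h l = begin
  isMatchingAvoiding (sel (A ++ B) (a ++ b)) h ∧ dominated (A ++ B) (a ++ b) G
    ≡⟨ cong₂ _∧_ (trans (cong (λ M → isMatchingAvoiding M h) (sel-++ A B a b l)) (isMatchingAvoiding-++ sA sB h))
                 (dominated-++ A B a b G l) ⟩
  (isMatchingAvoiding sA (h ∪ cB) ∧ isMatchingAvoiding sB (h ∪ cA)) ∧ (dominated A a G ∧ dominated B b G)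
    ≡⟨ interchange (isMatchingAvoiding sA (h ∪ cB)) _ (dominated A a G) _ ⟩
  (isMatchingAvoiding sA (h ∪ cB) ∧ dominated A a G) ∧ (isMatchingAvoiding sB (h ∪ cA) ∧ dominated B b G)
    ≡⟨ cong₂ (λ u w → (isMatchingAvoiding sA (h ∪ cB) ∧ u) ∧ (isMatchingAvoiding sB (h ∪ cA) ∧ w))
             (dominated-cong A a (≗⇒AgreeOn (λ v → trans (cong (_∨ h v) (covers-sel-++ A B a b l v))
                                                        (xy∙z≈x∙zy (cA v) (cB v) (h v))) A))
             (dominated-cong B b (≗⇒AgreeOn (λ v → trans (cong (_∨ h v) (covers-sel-++ A B a b l v))
                                                        (xy∙z≈y∙zx (cA v) (cB v) (h v))) B)) ⟩
  isMaximalMatchingAvoiding A a (h ∪ cB) ∧ isMaximalMatchingAvoiding B b (h ∪ cA)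
    ∎
  where
  open ≡-Reasoning
  sA sB : List Edge
  sA = sel A a
  sB = sel B b
  cA cB G : ℕ → Bool
  cA = covers sA
  cB = covers sB
  G = covers (sel (A ++ B) (a ++ b)) ∪ h

isMatchingAvoiding-sel-++ : ∀ A B a b h → length a ≡ length A →
  isMatchingAvoiding (sel (A ++ B) (a ++ b)) h ≡
  (isMatchingAvoiding (sel A a) (h ∪ covers (sel B b)) ∧ isMatchingAvoiding (sel B b) (h ∪ covers (sel A a)))
isMatchingAvoiding-sel-++ A B a b h la =
  trans (cong (λ M → isMatchingAvoiding M h) (sel-++ A B a b la)) (isMatchingAvoiding-++ (sel A a) (sel B b) h)

module PieceInterchange
  {X : Set} (_⊕_ : X → X → X) (cov : X → ℕ → Bool)
  (cov-⊕ : ∀ x y → cov (x ⊕ y) ≗ (cov x ∪ cov y))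
  (P : X → (ℕ → Bool) → Bool) (P-cong : ∀ x {g h} → g ≗ h → P x g ≡ P x h)
  (P-⊕ : ∀ x y h → P (x ⊕ y) h ≡ (P x (h ∪ cov y) ∧ P y (h ∪ cov x)))
  where

  P-interchange : ∀ a b c d h → P ((a ⊕ b) ⊕ (c ⊕ d)) h ≡ P ((a ⊕ c) ⊕ (b ⊕ d)) h
  P-interchange a b c d h = begin
    P ((a ⊕ b) ⊕ (c ⊕ d)) h
      ≡⟨ trans (P-⊕ (a ⊕ b) (c ⊕ d) h) (cong₂ _∧_ (P-⊕ a b _) (P-⊕ c d _)) ⟩
    (P a ((h ∪ cov (c ⊕ d)) ∪ cov b) ∧ P b ((h ∪ cov (c ⊕ d)) ∪ cov a)) ∧
    (P c ((h ∪ cov (a ⊕ b)) ∪ cov d) ∧ P d ((h ∪ cov (a ⊕ b)) ∪ cov c))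
      ≡⟨ interchange (P a _) (P b _) (P c _) (P d _) ⟩
    (P a ((h ∪ cov (c ⊕ d)) ∪ cov b) ∧ P c ((h ∪ cov (a ⊕ b)) ∪ cov d)) ∧
    (P b ((h ∪ cov (c ⊕ d)) ∪ cov a) ∧ P d ((h ∪ cov (a ⊕ b)) ∪ cov c))
      ≡⟨ cong₂ _∧_ (cong₂ _∧_ (P-cong a (regroup c d b b d c λ v → ρᵃ (h v) (A v) (B v) (C v) (D v)))
                              (P-cong c (regroup a b d b d a λ v → ρᶜ (h v) (A v) (B v) (C v) (D v))))
                   (cong₂ _∧_ (P-cong b (regroup c d a a c d λ v → ρᵇ (h v) (A v) (B v) (C v) (D v)))
                              (P-cong d (regroup a b c a c b λ v → ρᵈ (h v) (A v) (B v) (C v) (D v)))) ⟩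
    (P a ((h ∪ cov (b ⊕ d)) ∪ cov c) ∧ P c ((h ∪ cov (b ⊕ d)) ∪ cov a)) ∧
    (P b ((h ∪ cov (a ⊕ c)) ∪ cov d) ∧ P d ((h ∪ cov (a ⊕ c)) ∪ cov b))
      ≡⟨ trans (P-⊕ (a ⊕ c) (b ⊕ d) h) (cong₂ _∧_ (P-⊕ a c _) (P-⊕ b d _)) ⟨
    P ((a ⊕ c) ⊕ (b ⊕ d)) h
      ∎
    where
    open ≡-Reasoning
    regroup : ∀ x y z x′ y′ z′ →
      (∀ v → (h v ∨ (cov x v ∨ cov y v)) ∨ cov z v ≡ (h v ∨ (cov x′ v ∨ cov y′ v)) ∨ cov z′ v) →
      (h ∪ cov (x ⊕ y)) ∪ cov z ≗ (h ∪ cov (x′ ⊕ y′)) ∪ cov z′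
    regroup x y z x′ y′ z′ eq v =
      trans (cong (λ u → (h v ∨ u) ∨ cov z v) (cov-⊕ x y v))
            (trans (eq v) (cong (λ u → (h v ∨ u) ∨ cov z′ v) (sym (cov-⊕ x′ y′ v))))
    A B C D : ℕ → Bool
    A = cov a
    B = cov b
    C = cov c
    D = cov d
    ρᵃ : ∀ h A B C D → (h ∨ (C ∨ D)) ∨ B ≡ (h ∨ (B ∨ D)) ∨ C
    ρᵃ = truth-table 5
    ρᵇ : ∀ h A B C D → (h ∨ (C ∨ D)) ∨ A ≡ (h ∨ (A ∨ C)) ∨ D
    ρᵇ = truth-table 5
    ρᶜ : ∀ h A B C D → (h ∨ (A ∨ B)) ∨ D ≡ (h ∨ (B ∨ D)) ∨ A
    ρᶜ = truth-table 5
    ρᵈ : ∀ h A B C D → (h ∨ (A ∨ B)) ∨ C ≡ (h ∨ (A ∨ C)) ∨ B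
    ρᵈ = truth-table 5

record Selection : Set where
  constructor selection
  field
    edges : List Edge
    bits : List Bool
    bits-length : length bits ≡ length edges

_⊕_ : Selection → Selection → Selection
selection A a la ⊕ selection B b lb =
  selection (A ++ B) (a ++ b) (trans (length-++ a) (trans (cong₂ _+_ la lb) (sym (length-++ A))))

coveredBy : Selection → ℕ → Bool
coveredBy (selection A a _) = covers (sel A a)

coveredBy-⊕ : ∀ x y → coveredBy (x ⊕ y) ≗ (coveredBy x ∪ coveredBy y)
coveredBy-⊕ (selection A a la) (selection B b _) = covers-sel-++ A B a b la

maximalAvoiding : Selection → (ℕ → Bool) → Bool
maximalAvoiding (selection A a _) = isMaximalMatchingAvoiding A a

maximalAvoiding-cong : ∀ x {g h} → g ≗ h → maximalAvoiding x g ≡ maximalAvoiding x h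
maximalAvoiding-cong (selection A a _) g≗h = isMaximalMatchingAvoiding-cong A a (≗⇒AgreeOn g≗h A)

maximalAvoiding-⊕ : ∀ x y h →
  maximalAvoiding (x ⊕ y) h ≡ (maximalAvoiding x (h ∪ coveredBy y) ∧ maximalAvoiding y (h ∪ coveredBy x))
maximalAvoiding-⊕ (selection A a la) (selection B b _) h = isMaximalMatchingAvoiding-++ A B a b h la

matchingAvoiding : Selection → (ℕ → Bool) → Bool
matchingAvoiding (selection A a _) = isMatchingAvoiding (sel A a)

matchingAvoiding-cong : ∀ x {g h} → g ≗ h → matchingAvoiding x g ≡ matchingAvoiding x h
matchingAvoiding-cong (selection A a _) g≗h = isMatchingAvoiding-cong (sel A a) (≗⇒AgreeOn g≗h (sel A a))

matchingAvoiding-⊕ : ∀ x y h →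
  matchingAvoiding (x ⊕ y) h ≡ (matchingAvoiding x (h ∪ coveredBy y) ∧ matchingAvoiding y (h ∪ coveredBy x))
matchingAvoiding-⊕ (selection A a la) (selection B b _) h = isMatchingAvoiding-sel-++ A B a b h la

module MaximalInterchange = PieceInterchange _⊕_ coveredBy coveredBy-⊕ maximalAvoiding maximalAvoiding-cong maximalAvoiding-⊕
module MatchingInterchange = PieceInterchange _⊕_ coveredBy coveredBy-⊕ matchingAvoiding matchingAvoiding-cong matchingAvoiding-⊕

relabel : (ℕ → ℕ) → List Edge → List Edge
relabel f = map (λ (a , b) → (f a , f b))

module Relabel (f : ℕ → ℕ) (f-≡ᵇ : ∀ m n → (f m ≡ᵇ f n) ≡ (m ≡ᵇ n)) where

  disjointᵇ-relabel : ∀ a b c d → disjointᵇ (f a , f b) (f c , f d) ≡ disjointᵇ (a , b) (c , d)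
  disjointᵇ-relabel a b c d rewrite f-≡ᵇ a c | f-≡ᵇ a d | f-≡ᵇ b c | f-≡ᵇ b d = refl

  isMatching-relabel : ∀ M → isMatchingᵇ (relabel f M) ≡ isMatchingᵇ M
  isMatching-relabel [] = refl
  isMatching-relabel ((a , b) ∷ M) = cong₂ _∧_ (all-disjoint M) (isMatching-relabel M)
    where
    all-disjoint : ∀ M → all (disjointᵇ (f a , f b)) (relabel f M) ≡ all (disjointᵇ (a , b)) M
    all-disjoint [] = refl
    all-disjoint ((c , d) ∷ M) = cong₂ _∧_ (disjointᵇ-relabel a b c d) (all-disjoint M)

  isMatchingAvoiding-relabel : ∀ M h → isMatchingAvoiding (relabel f M) h ≡ isMatchingAvoiding M (h ∘ f)
  isMatchingAvoiding-relabel M h = cong₂ _∧_ (isMatching-relabel M) (all-avoids M)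
    where
    all-avoids : ∀ M → all (avoids h) (relabel f M) ≡ all (avoids (h ∘ f)) M
    all-avoids [] = refl
    all-avoids ((a , b) ∷ M) = cong (avoids h (f a , f b) ∧_) (all-avoids M)

  covers-relabel : ∀ M v → covers (relabel f M) (f v) ≡ covers M v
  covers-relabel [] v = refl
  covers-relabel ((a , b) ∷ M) v rewrite f-≡ᵇ v a | f-≡ᵇ v b = cong (((v ≡ᵇ a) ∨ (v ≡ᵇ b)) ∨_) (covers-relabel M v)

  sel-relabel : ∀ E c → sel (relabel f E) c ≡ relabel f (sel E c)
  sel-relabel [] c = refl
  sel-relabel (e ∷ E) [] = refl
  sel-relabel (e ∷ E) (true ∷ c) = cong (_ ∷_) (sel-relabel E c)
  sel-relabel (e ∷ E) (false ∷ c) = sel-relabel E c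

  dominated-relabel : ∀ E c g → dominated (relabel f E) c g ≡ dominated E c (g ∘ f)
  dominated-relabel [] c g = refl
  dominated-relabel (e ∷ E) [] g = refl
  dominated-relabel (e ∷ E) (true ∷ c) g = dominated-relabel E c g
  dominated-relabel ((a , b) ∷ E) (false ∷ c) g = cong ((g (f a) ∨ g (f b)) ∧_) (dominated-relabel E c g)

  isMaximalMatchingAvoiding-relabel : ∀ E c h →
    isMaximalMatchingAvoiding (relabel f E) c h ≡ isMaximalMatchingAvoiding E c (h ∘ f)
  isMaximalMatchingAvoiding-relabel E c h
    rewrite sel-relabel E c | isMatchingAvoiding-relabel (sel E c) h =
    cong (isMatchingAvoiding (sel E c) (h ∘ f) ∧_)
      (trans (dominated-relabel E c _)
             (dominated-cong E c (≗⇒AgreeOn (λ v → cong (_∨ h (f v)) (covers-relabel (sel E c) v)) E)))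

covers-sel-outside : ∀ E c v → All (λ e → touches v e ≡ false) E → covers (sel E c) v ≡ false
covers-sel-outside [] c v [] = refl
covers-sel-outside (e ∷ E) [] v _ = refl
covers-sel-outside (e ∷ E) (true ∷ c) v (ve ∷ vE) = cong₂ _∨_ ve (covers-sel-outside E c v vE)
covers-sel-outside (e ∷ E) (false ∷ c) v (ve ∷ vE) = covers-sel-outside E c v vE

blockEdges : ℕ → ℕ → List Edge
blockEdges s t = (1 + s , 2 + s) ∷ (2 + s , 3 + s) ∷ (3 + s , 4 + s) ∷ (1 + s , t) ∷ []

-- Block edges a = (1, 2), b = (2, 3), c = (3, 4) and y = (1, t), counted from the block start;
-- p says that vertex 1 is covered from outside the block, r the same for vertex 4.
matchingBlock : Bool → Bool → Bool → Bool → Bool → Bool → Bool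
matchingBlock p r a b c y =
  not (a ∧ b) ∧ not (b ∧ c) ∧ not (a ∧ y) ∧ not (a ∧ p) ∧ not (c ∧ r) ∧ not (y ∧ p)

maximalBlock : Bool → Bool → Bool → Bool → Bool → Bool → Bool
maximalBlock p r a b c y =
  matchingBlock p r a b c y ∧ (a ∨ b ∨ y ∨ p) ∧ (b ∨ a ∨ c) ∧ (c ∨ b ∨ r) ∧ (y ∨ a ∨ p)

blockBoundary : Bool → Bool → ℕ → Bool
blockBoundary p r 1 = p
blockBoundary p r 4 = r
blockBoundary p r _ = false

-- The pendant vertex 5 + u is only compared with 1, …, 4, so evaluation never gets stuck on u.
maximalBlock-standard : ∀ u p r a b c y →
  isMaximalMatchingAvoiding (blockEdges 0 (5 + u)) (a ∷ b ∷ c ∷ y ∷ []) (blockBoundary p r) ≡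
  maximalBlock p r a b c y
maximalBlock-standard u = truth-table 6

matchingBlock-standard : ∀ u p r a b c y →
  isMatchingAvoiding (sel (blockEdges 0 (5 + u)) (a ∷ b ∷ c ∷ y ∷ [])) (blockBoundary p r) ≡
  matchingBlock p r a b c y
matchingBlock-standard u = truth-table 6

covers-block-standard : ∀ u a b c y → covers (sel (blockEdges 0 (5 + u)) (a ∷ b ∷ c ∷ y ∷ [])) 4 ≡ c
covers-block-standard u = truth-table 4

blockEdges-relabel : ∀ s d → blockEdges s (s + d) ≡ relabel (_+_ s) (blockEdges 0 d)
blockEdges-relabel s d rewrite +-comm s 1 | +-comm s 2 | +-comm s 3 | +-comm s 4 = refl

≤-offset : ∀ {s t} n → n + s ≤ t → Σ ℕ λ u → t ≡ s + (n + u)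
≤-offset {s} {t} n le =
  t ∸ (n + s) , trans (sym (m+[n∸m]≡n le)) (trans (cong (_+ (t ∸ (n + s))) (+-comm n s)) (+-assoc s n _))

blockBoundary-agrees : ∀ s u k → k (2 + s) ≡ false → k (3 + s) ≡ false → k (s + (5 + u)) ≡ false →
  AgreeOn (blockEdges 0 (5 + u)) (k ∘ (_+_ s)) (blockBoundary (k (1 + s)) (k (4 + s)))
blockBoundary-agrees s u k k₂ k₃ kₜ =
  (k+ 1 , trans (k+ 2) k₂) ∷ (trans (k+ 2) k₂ , trans (k+ 3) k₃) ∷ (trans (k+ 3) k₃ , k+ 4) ∷ (k+ 1 , kₜ) ∷ []
  where
  k+ : ∀ n → k (s + n) ≡ k (n + s)
  k+ n = cong k (+-comm s n)

maximalBlock-correct : ∀ s t k a b c y → 5 + s ≤ t →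
  k (2 + s) ≡ false → k (3 + s) ≡ false → k t ≡ false →
  isMaximalMatchingAvoiding (blockEdges s t) (a ∷ b ∷ c ∷ y ∷ []) k ≡ maximalBlock (k (1 + s)) (k (4 + s)) a b c y
maximalBlock-correct s t k a b c y le k₂ k₃ kₜ with ≤-offset 5 le
... | u , refl = begin
  isMaximalMatchingAvoiding (blockEdges s (s + (5 + u))) bits k
    ≡⟨ cong (λ E → isMaximalMatchingAvoiding E bits k) (blockEdges-relabel s (5 + u)) ⟩
  isMaximalMatchingAvoiding (relabel (_+_ s) (blockEdges 0 (5 + u))) bits k
    ≡⟨ isMaximalMatchingAvoiding-relabel (blockEdges 0 (5 + u)) bits k ⟩
  isMaximalMatchingAvoiding (blockEdges 0 (5 + u)) bits (k ∘ (_+_ s))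
    ≡⟨ isMaximalMatchingAvoiding-cong (blockEdges 0 (5 + u)) bits (blockBoundary-agrees s u k k₂ k₃ kₜ) ⟩
  isMaximalMatchingAvoiding (blockEdges 0 (5 + u)) bits (blockBoundary (k (1 + s)) (k (4 + s)))
    ≡⟨ maximalBlock-standard u (k (1 + s)) (k (4 + s)) a b c y ⟩
  maximalBlock (k (1 + s)) (k (4 + s)) a b c y
    ∎
  where
  open ≡-Reasoning
  open Relabel (_+_ s) (+-≡ᵇ s)
  bits : List Bool
  bits = a ∷ b ∷ c ∷ y ∷ []

matchingBlock-correct : ∀ s t k a b c y → 5 + s ≤ t →
  k (2 + s) ≡ false → k (3 + s) ≡ false → k t ≡ false →
  isMatchingAvoiding (sel (blockEdges s t) (a ∷ b ∷ c ∷ y ∷ [])) k ≡ matchingBlock (k (1 + s)) (k (4 + s)) a b c y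
matchingBlock-correct s t k a b c y le k₂ k₃ kₜ with ≤-offset 5 le
... | u , refl = begin
  isMatchingAvoiding (sel (blockEdges s (s + (5 + u))) bits) k
    ≡⟨ cong (λ E → isMatchingAvoiding (sel E bits) k) (blockEdges-relabel s (5 + u)) ⟩
  isMatchingAvoiding (sel (relabel (_+_ s) (blockEdges 0 (5 + u))) bits) k
    ≡⟨ cong (λ M → isMatchingAvoiding M k) (sel-relabel (blockEdges 0 (5 + u)) bits) ⟩
  isMatchingAvoiding (relabel (_+_ s) (sel (blockEdges 0 (5 + u)) bits)) k
    ≡⟨ isMatchingAvoiding-relabel (sel (blockEdges 0 (5 + u)) bits) k ⟩
  isMatchingAvoiding (sel (blockEdges 0 (5 + u)) bits) (k ∘ (_+_ s))
    ≡⟨ isMatchingAvoiding-cong (sel (blockEdges 0 (5 + u)) bits)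
         (AgreeOn-sel (blockEdges 0 (5 + u)) bits (blockBoundary-agrees s u k k₂ k₃ kₜ)) ⟩
  isMatchingAvoiding (sel (blockEdges 0 (5 + u)) bits) (blockBoundary (k (1 + s)) (k (4 + s)))
    ≡⟨ matchingBlock-standard u (k (1 + s)) (k (4 + s)) a b c y ⟩
  matchingBlock (k (1 + s)) (k (4 + s)) a b c y
    ∎
  where
  open ≡-Reasoning
  open Relabel (_+_ s) (+-≡ᵇ s)
  bits : List Bool
  bits = a ∷ b ∷ c ∷ y ∷ []

covers-block-last : ∀ s t a b c y → 5 + s ≤ t → covers (sel (blockEdges s t) (a ∷ b ∷ c ∷ y ∷ [])) (4 + s) ≡ c
covers-block-last s t a b c y le with ≤-offset 5 le
... | u , refl = begin
  covers (sel (blockEdges s (s + (5 + u))) bits) (4 + s)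
    ≡⟨ cong₂ (λ E v → covers (sel E bits) v) (blockEdges-relabel s (5 + u)) (+-comm 4 s) ⟩
  covers (sel (relabel (_+_ s) (blockEdges 0 (5 + u))) bits) (s + 4)
    ≡⟨ cong (λ M → covers M (s + 4)) (sel-relabel (blockEdges 0 (5 + u)) bits) ⟩
  covers (relabel (_+_ s) (sel (blockEdges 0 (5 + u)) bits)) (s + 4)
    ≡⟨ covers-relabel (sel (blockEdges 0 (5 + u)) bits) 4 ⟩
  covers (sel (blockEdges 0 (5 + u)) bits) 4
    ≡⟨ covers-block-standard u a b c y ⟩
  c ∎
  where
  open ≡-Reasoning
  open Relabel (_+_ s) (+-≡ᵇ s)
  bits : List Bool
  bits = a ∷ b ∷ c ∷ y ∷ []

covers-block-beyond : ∀ s t bits v → 4 + s <ₙ v → (v ≡ᵇ t) ≡ false → covers (sel (blockEdges s t) bits) v ≡ false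
covers-block-beyond s t bits v far v≢t =
  covers-sel-outside (blockEdges s t) bits v
    (cong₂ _∨_ (beyond 3) (beyond 2) ∷ cong₂ _∨_ (beyond 2) (beyond 1) ∷ cong₂ _∨_ (beyond 1) (beyond 0) ∷
     cong₂ _∨_ (beyond 3) v≢t ∷ [])
  where
  beyond : ∀ i → (v ≡ᵇ (4 ∸ i) + s) ≡ false
  beyond i = >⇒≡ᵇ-false (≤-<-trans (+-monoˡ-≤ s (m∸n≤m 4 i)) far)

three : ℕ → ℕ
three zero = zero
three (suc j) = 3 + three j

+-three : ∀ s j → s + three (suc j) ≡ 3 + (s + three j)
+-three s j = trans (+-suc s _) (cong suc (trans (+-suc s _) (cong suc (+-suc s _))))

pathEdges : ℕ → ℕ → List Edge
pathEdges s zero = []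
pathEdges s (suc m) = (1 + s , 2 + s) ∷ pathEdges (1 + s) m

pendantEdges : ℕ → ℕ → ℕ → List Edge
pendantEdges s t zero = []
pendantEdges s t (suc m) = (1 + s , t) ∷ pendantEdges (3 + s) (1 + t) m

chainEdges : ℕ → ℕ → ℕ → List Edge
chainEdges s t j = pathEdges s (three j) ++ pendantEdges s t (suc j)

length-pathEdges : ∀ s m → length (pathEdges s m) ≡ m
length-pathEdges s zero = refl
length-pathEdges s (suc m) = cong suc (length-pathEdges (suc s) m)

length-pendantEdges : ∀ s t m → length (pendantEdges s t m) ≡ m
length-pendantEdges s t zero = refl
length-pendantEdges s t (suc m) = cong suc (length-pendantEdges (3 + s) (suc t) m)

Untouched : ℕ → List Edge → Set
Untouched v = All (λ e → touches v e ≡ false)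

pathEdges-untouched : ∀ s m v → v ≤ s ⊎ 2 + (s + m) ≤ v → Untouched v (pathEdges s m)
pathEdges-untouched s zero v _ = []
pathEdges-untouched s (suc m) v (inj₁ v≤s) =
  cong₂ _∨_ (<⇒≡ᵇ-false (s≤s v≤s)) (<⇒≡ᵇ-false (s≤s (m≤n⇒m≤1+n v≤s))) ∷
  pathEdges-untouched (suc s) m v (inj₁ (m≤n⇒m≤1+n v≤s))
pathEdges-untouched s (suc m) v (inj₂ far) =
  cong₂ _∨_ (>⇒≡ᵇ-false (<-trans (n<1+n (suc s)) 2+s<v)) (>⇒≡ᵇ-false 2+s<v) ∷
  pathEdges-untouched (suc s) m v (inj₂ far′)
  where
  far′ : 2 + (suc s + m) ≤ v
  far′ = subst (λ n → 2 + n ≤ v) (+-suc s m) far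
  2+s<v : 2 + s <ₙ v
  2+s<v = ≤-trans (s≤s (s≤s (s≤s (m≤m+n s m)))) far′

pendantEdges-untouched : ∀ s t m v → v <ₙ t → v ≤ s ⊎ s + three m ≤ suc v → Untouched v (pendantEdges s t m)
pendantEdges-untouched s t zero v _ _ = []
pendantEdges-untouched s t (suc m) v v<t (inj₁ v≤s) =
  cong₂ _∨_ (<⇒≡ᵇ-false (s≤s v≤s)) (<⇒≡ᵇ-false v<t) ∷
  pendantEdges-untouched (3 + s) (suc t) m v (m<n⇒m<1+n v<t) (inj₁ (≤-trans v≤s (m≤n+m s 3)))
pendantEdges-untouched s t (suc m) v v<t (inj₂ far) =
  cong₂ _∨_ (>⇒≡ᵇ-false (≤-pred (≤-trans (s≤s (s≤s (s≤s (m≤m+n s (three m))))) far′))) (<⇒≡ᵇ-false v<t) ∷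
  pendantEdges-untouched (3 + s) (suc t) m v (m<n⇒m<1+n v<t) (inj₂ far′)
  where
  far′ : 3 + (s + three m) ≤ suc v
  far′ = subst (_≤ suc v) (+-three s m) far

chainEdges-untouched : ∀ s t j v → v <ₙ t → v ≤ s ⊎ 2 + (s + three j) ≤ v → Untouched v (chainEdges s t j)
chainEdges-untouched s t j v v<t (inj₁ v≤s) =
  ++⁺ (pathEdges-untouched s (three j) v (inj₁ v≤s)) (pendantEdges-untouched s t (suc j) v v<t (inj₁ v≤s))
chainEdges-untouched s t j v v<t (inj₂ far) =
  ++⁺ (pathEdges-untouched s (three j) v (inj₂ far))
      (pendantEdges-untouched s t (suc j) v v<t (inj₂ (subst (_≤ suc v) (sym (+-three s j)) (s≤s far))))

headᵇ : List Bool → Bool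
headᵇ [] = false
headᵇ (b ∷ _) = b

covers-chain-first : ∀ s t j x y → length x ≡ three j → 1 + s <ₙ t →
  covers (sel (chainEdges s t j) (x ++ y)) (1 + s) ≡ (headᵇ x ∨ headᵇ y)
covers-chain-first s t j x y lx 1+s<t =
  trans (covers-sel-++ (pathEdges s (three j)) (pendantEdges s t (suc j)) x y
           (trans lx (sym (length-pathEdges s (three j)))) (1 + s))
        (cong₂ _∨_ (path-first (three j) x lx) (pendant-first y))
  where
  path-first : ∀ m x → length x ≡ m → covers (sel (pathEdges s m) x) (1 + s) ≡ headᵇ x
  path-first zero [] _ = refl
  path-first (suc m) (true ∷ x) _ rewrite ≡ᵇ-refl s = refl
  path-first (suc m) (false ∷ x) _ =
    covers-sel-outside (pathEdges (1 + s) m) x (1 + s) (pathEdges-untouched (1 + s) m (1 + s) (inj₁ ≤-refl))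
  pendant-first : ∀ y → covers (sel (pendantEdges s t (suc j)) y) (1 + s) ≡ headᵇ y
  pendant-first [] = refl
  pendant-first (true ∷ y) rewrite ≡ᵇ-refl s = refl
  pendant-first (false ∷ y) =
    covers-sel-outside (pendantEdges (3 + s) (suc t) j) y (1 + s)
      (pendantEdges-untouched (3 + s) (suc t) j (1 + s) (m<n⇒m<1+n 1+s<t) (inj₁ (s≤s (m≤n+m s 2))))

-- The block after a maximal block has its first vertex covered exactly when c is unselected.
MaximalChain : Bool → List Bool → List Bool → Bool
MaximalChain p [] (y ∷ []) = y xor p
MaximalChain p (a ∷ b ∷ c ∷ x) (y ∷ ys) = maximalBlock p (not c) a b c y ∧ MaximalChain c x ys
MaximalChain _ _ _ = false

MatchingChain : Bool → List Bool → List Bool → Bool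
MatchingChain p [] (y ∷ []) = not (y ∧ p)
MatchingChain p (a ∷ b ∷ c ∷ x) (y ∷ ys) = matchingBlock p false a b c y ∧ MatchingChain c x ys
MatchingChain _ _ _ = false

maximalChain-head : ∀ p x y → MaximalChain p x y ≡ true → (headᵇ x ∨ headᵇ y) ≡ not p
maximalChain-head false [] (true ∷ []) _ = refl
maximalChain-head true [] (false ∷ []) _ = refl
maximalChain-head p (a ∷ b ∷ c ∷ x) (y ∷ ys) chain =
  subst (λ m → m ∧ (a ∨ y) ≡ m ∧ not p) (∧-conicalˡ (maximalBlock p (not c) a b c y) _ chain)
        (covers-first p (not c) a b c y)
  where
  covers-first : ∀ p r a b c y → maximalBlock p r a b c y ∧ (a ∨ y) ≡ maximalBlock p r a b c y ∧ not p
  covers-first = truth-table 6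

matchingChain-head : ∀ p x y → MatchingChain p x y ≡ true → (p ∧ (headᵇ x ∨ headᵇ y)) ≡ false
matchingChain-head false [] (y ∷ []) _ = refl
matchingChain-head true [] (false ∷ []) _ = refl
matchingChain-head p (a ∷ b ∷ c ∷ x) (y ∷ ys) chain =
  subst (λ m → m ∧ (p ∧ (a ∨ y)) ≡ false) (∧-conicalˡ (matchingBlock p false a b c y) _ chain)
        (first-free p false a b c y)
  where
  first-free : ∀ p r a b c y → matchingBlock p r a b c y ∧ (p ∧ (a ∨ y)) ≡ false
  first-free = truth-table 6

maximalBlock-before-chain : ∀ p a b c y x ys →
  (maximalBlock p (headᵇ x ∨ headᵇ ys) a b c y ∧ MaximalChain c x ys) ≡ MaximalChain p (a ∷ b ∷ c ∷ x) (y ∷ ys)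
maximalBlock-before-chain p a b c y x ys with MaximalChain c x ys in chain
... | true = cong (λ r → maximalBlock p r a b c y ∧ true) (maximalChain-head c x ys chain)
... | false = trans (∧-zeroʳ _) (sym (∧-zeroʳ _))

matchingBlock-before-chain : ∀ p a b c y x ys →
  (matchingBlock p (headᵇ x ∨ headᵇ ys) a b c y ∧ MatchingChain c x ys) ≡ MatchingChain p (a ∷ b ∷ c ∷ x) (y ∷ ys)
matchingBlock-before-chain p a b c y x ys with MatchingChain c x ys in chain
... | true =
  cong (_∧ true) (trans (last-edge-free p (headᵇ x ∨ headᵇ ys) a b c y)
                 (trans (cong (λ z → matchingBlock p false a b c y ∧ not z) (matchingChain-head c x ys chain))
                        (∧-identityʳ _)))
  where
  last-edge-free : ∀ p r a b c y → matchingBlock p r a b c y ≡ matchingBlock p false a b c y ∧ not (c ∧ r)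
  last-edge-free = truth-table 6
... | false = trans (∧-zeroʳ _) (sym (∧-zeroʳ _))

Quiet : ℕ → ℕ → ℕ → (ℕ → Bool) → Set
Quiet s t j h = (∀ v → 1 + s <ₙ v → v ≤ 1 + (s + three j) → h v ≡ false) × (∀ v → t ≤ v → h v ≡ false)

module ChainStep (j s t : ℕ) (h : ℕ → Bool) (a b c y₀ : Bool) (x y : List Bool) (lx : length x ≡ three j)
  (bound : 2 + (s + three (suc j)) ≤ t) (quiet : Quiet s t (suc j) h) where

  bound′ : 5 + (s + three j) ≤ t
  bound′ = subst (λ n → 2 + n ≤ t) (+-three s j) bound

  room : 5 + s ≤ t
  room = ≤-trans (+-monoʳ-≤ 5 (m≤m+n s (three j))) bound′

  inside : ∀ i → 1 <ₙ i → i ≤ 4 → h (i + s) ≡ false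
  inside i 1<i i≤4 =
    proj₁ quiet (i + s) (+-monoˡ-< s 1<i)
      (subst (λ n → i + s ≤ 1 + n) (sym (+-three s j)) (≤-trans (+-monoˡ-≤ s i≤4) (+-monoʳ-≤ 4 (m≤m+n s (three j)))))

  restBits : List Bool
  restBits = x ++ y

  rest : List Edge
  rest = sel (chainEdges (3 + s) (suc t) j) restBits

  blockBits : List Bool
  blockBits = a ∷ b ∷ c ∷ y₀ ∷ []

  block : List Edge
  block = sel (blockEdges s t) blockBits

  rest-untouched : ∀ v → v ≤ 3 + s ⊎ 5 + (s + three j) ≤ v → v ≤ t → covers rest v ≡ false
  rest-untouched v where≤ v≤t =
    covers-sel-outside (chainEdges (3 + s) (suc t) j) restBits v (chainEdges-untouched (3 + s) (suc t) j v (s≤s v≤t) where≤)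

  rest-near : ∀ i → i ≤ 3 → covers rest (i + s) ≡ false
  rest-near i i≤3 =
    rest-untouched (i + s) (inj₁ (+-monoˡ-≤ s i≤3))
      (≤-trans (+-monoˡ-≤ s (≤-trans i≤3 (n≤1+n 3))) (≤-trans (n≤1+n (4 + s)) room))

  block-input : (h ∪ covers rest) (1 + s) ≡ h (1 + s)
  block-input = trans (cong (h (1 + s) ∨_) (rest-near 1 (s≤s z≤n))) (∨-identityʳ _)

  block-inner : ∀ i → 1 <ₙ i → i ≤ 3 → (h ∪ covers rest) (i + s) ≡ false
  block-inner i 1<i i≤3 = cong₂ _∨_ (inside i 1<i (≤-trans i≤3 (n≤1+n 3))) (rest-near i i≤3)

  block-pendant : (h ∪ covers rest) t ≡ false
  block-pendant = cong₂ _∨_ (proj₂ quiet t ≤-refl) (rest-untouched t (inj₂ bound′) ≤-refl)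

  block-output : (h ∪ covers rest) (4 + s) ≡ (headᵇ x ∨ headᵇ y)
  block-output =
    trans (cong (_∨ covers rest (4 + s)) (inside 4 (s≤s (s≤s z≤n)) ≤-refl))
          (covers-chain-first (3 + s) (suc t) j x y lx (s≤s (≤-trans (n≤1+n (4 + s)) room)))

  rest-input : (h ∪ covers block) (4 + s) ≡ c
  rest-input = trans (cong (_∨ covers block (4 + s)) (inside 4 (s≤s (s≤s z≤n)) ≤-refl)) (covers-block-last s t a b c y₀ room)

  rest-quiet : Quiet (3 + s) (suc t) j (h ∪ covers block)
  rest-quiet =
    (λ v lo hi → cong₂ _∨_
       (proj₁ quiet v (<-trans (+-monoˡ-< s (s≤s (s≤s z≤n))) lo) (subst (λ n → v ≤ 1 + n) (sym (+-three s j)) hi))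
       (covers-block-beyond s t blockBits v lo (<⇒≡ᵇ-false (≤-<-trans hi bound′)))) ,
    (λ v t<v → cong₂ _∨_ (proj₂ quiet v (≤-trans (n≤1+n t) t<v))
                         (covers-block-beyond s t blockBits v (<-trans room t<v) (>⇒≡ᵇ-false t<v)))

  rest-bound : 2 + ((3 + s) + three j) ≤ suc t
  rest-bound = m≤n⇒m≤1+n bound′

maximalChain-correct : ∀ j s t x y h → length x ≡ three j → length y ≡ suc j →
  2 + (s + three j) ≤ t → Quiet s t j h →
  isMaximalMatchingAvoiding (chainEdges s t j) (x ++ y) h ≡ MaximalChain (h (1 + s)) x y
maximalChain-correct zero s t [] (true ∷ []) h _ _ _ (_ , beyond) rewrite beyond t ≤-refl with h (1 + s)
... | true = refl
... | false = refl
maximalChain-correct zero s t [] (false ∷ []) h _ _ _ (_ , beyond) rewrite beyond t ≤-refl with h (1 + s)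
... | true = refl
... | false = refl
maximalChain-correct (suc j) s t (a ∷ b ∷ c ∷ x) (y₀ ∷ y) h lx ly bound quiet = begin
  isMaximalMatchingAvoiding (chainEdges s t (suc j)) ((a ∷ b ∷ c ∷ x) ++ (y₀ ∷ y)) h
    ≡⟨ MaximalInterchange.P-interchange
         (selection (pathEdges s 3) (a ∷ b ∷ c ∷ []) refl)
         (selection (pathEdges (3 + s) (three j)) x (trans lx′ (sym (length-pathEdges _ _))))
         (selection (pendantEdges s t 1) (y₀ ∷ []) refl)
         (selection (pendantEdges (3 + s) (suc t) (suc j)) y (trans ly′ (sym (length-pendantEdges _ _ _))))
         h ⟩
  isMaximalMatchingAvoiding (blockEdges s t ++ chainEdges (3 + s) (suc t) j) (blockBits ++ restBits) h
    ≡⟨ isMaximalMatchingAvoiding-++ (blockEdges s t) (chainEdges (3 + s) (suc t) j) blockBits restBits h refl ⟩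
  isMaximalMatchingAvoiding (blockEdges s t) blockBits (h ∪ covers rest) ∧
  isMaximalMatchingAvoiding (chainEdges (3 + s) (suc t) j) restBits (h ∪ covers block)
    ≡⟨ cong₂ _∧_ (maximalBlock-correct s t (h ∪ covers rest) a b c y₀ room
                    (block-inner 2 ≤-refl (s≤s (s≤s z≤n))) (block-inner 3 (s≤s (s≤s z≤n)) ≤-refl) block-pendant)
                 (maximalChain-correct j (3 + s) (suc t) x y (h ∪ covers block) lx′ ly′ rest-bound rest-quiet) ⟩
  maximalBlock ((h ∪ covers rest) (1 + s)) ((h ∪ covers rest) (4 + s)) a b c y₀ ∧
  MaximalChain ((h ∪ covers block) (4 + s)) x y
    ≡⟨ cong₂ _∧_ (cong₂ (λ p r → maximalBlock p r a b c y₀) block-input block-output)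
                 (cong (λ q → MaximalChain q x y) rest-input) ⟩
  maximalBlock (h (1 + s)) (headᵇ x ∨ headᵇ y) a b c y₀ ∧ MaximalChain c x y
    ≡⟨ maximalBlock-before-chain (h (1 + s)) a b c y₀ x y ⟩
  MaximalChain (h (1 + s)) (a ∷ b ∷ c ∷ x) (y₀ ∷ y)
    ∎
  where
  open ≡-Reasoning
  lx′ : length x ≡ three j
  lx′ = suc-injective (suc-injective (suc-injective lx))
  ly′ : length y ≡ suc j
  ly′ = suc-injective ly
  open ChainStep j s t h a b c y₀ x y lx′ bound quiet

matchingChain-correct : ∀ j s t x y h → length x ≡ three j → length y ≡ suc j →
  2 + (s + three j) ≤ t → Quiet s t j h →
  isMatchingAvoiding (sel (chainEdges s t j) (x ++ y)) h ≡ MatchingChain (h (1 + s)) x y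
matchingChain-correct zero s t [] (true ∷ []) h _ _ _ (_ , beyond) rewrite beyond t ≤-refl with h (1 + s)
... | true = refl
... | false = refl
matchingChain-correct zero s t [] (false ∷ []) h _ _ _ _ = refl
matchingChain-correct (suc j) s t (a ∷ b ∷ c ∷ x) (y₀ ∷ y) h lx ly bound quiet = begin
  isMatchingAvoiding (sel (chainEdges s t (suc j)) ((a ∷ b ∷ c ∷ x) ++ (y₀ ∷ y))) h
    ≡⟨ MatchingInterchange.P-interchange
         (selection (pathEdges s 3) (a ∷ b ∷ c ∷ []) refl)
         (selection (pathEdges (3 + s) (three j)) x (trans lx′ (sym (length-pathEdges _ _))))
         (selection (pendantEdges s t 1) (y₀ ∷ []) refl)
         (selection (pendantEdges (3 + s) (suc t) (suc j)) y (trans ly′ (sym (length-pendantEdges _ _ _))))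
         h ⟩
  isMatchingAvoiding (sel (blockEdges s t ++ chainEdges (3 + s) (suc t) j) (blockBits ++ restBits)) h
    ≡⟨ isMatchingAvoiding-sel-++ (blockEdges s t) (chainEdges (3 + s) (suc t) j) blockBits restBits h refl ⟩
  isMatchingAvoiding block (h ∪ covers rest) ∧ isMatchingAvoiding rest (h ∪ covers block)
    ≡⟨ cong₂ _∧_ (matchingBlock-correct s t (h ∪ covers rest) a b c y₀ room
                    (block-inner 2 ≤-refl (s≤s (s≤s z≤n))) (block-inner 3 (s≤s (s≤s z≤n)) ≤-refl) block-pendant)
                 (matchingChain-correct j (3 + s) (suc t) x y (h ∪ covers block) lx′ ly′ rest-bound rest-quiet) ⟩
  matchingBlock ((h ∪ covers rest) (1 + s)) ((h ∪ covers rest) (4 + s)) a b c y₀ ∧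
  MatchingChain ((h ∪ covers block) (4 + s)) x y
    ≡⟨ cong₂ _∧_ (cong₂ (λ p r → matchingBlock p r a b c y₀) block-input block-output)
                 (cong (λ q → MatchingChain q x y) rest-input) ⟩
  matchingBlock (h (1 + s)) (headᵇ x ∨ headᵇ y) a b c y₀ ∧ MatchingChain c x y
    ≡⟨ matchingBlock-before-chain (h (1 + s)) a b c y₀ x y ⟩
  MatchingChain (h (1 + s)) (a ∷ b ∷ c ∷ x) (y₀ ∷ y)
    ∎
  where
  open ≡-Reasoning
  lx′ : length x ≡ three j
  lx′ = suc-injective (suc-injective (suc-injective lx))
  ly′ : length y ≡ suc j
  ly′ = suc-injective ly
  open ChainStep j s t h a b c y₀ x y lx′ bound quiet

applyUpTo-pathEdges : ∀ s m (f : ℕ → Edge) → (∀ k → f k ≡ (1 + (s + k) , 2 + (s + k))) → applyUpTo f m ≡ pathEdges s m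
applyUpTo-pathEdges s zero f f≡ = refl
applyUpTo-pathEdges s (suc m) f f≡ =
  cong₂ _∷_ (trans (f≡ 0) (cong (λ n → (1 + n , 2 + n)) (+-identityʳ s)))
            (applyUpTo-pathEdges (suc s) m (f ∘ suc) (λ k → trans (f≡ (suc k)) (cong (λ n → (1 + n , 2 + n)) (+-suc s k))))

applyUpTo-pendantEdges : ∀ s t m (f : ℕ → Edge) → (∀ k → f k ≡ (1 + (s + three k) , t + k)) →
  applyUpTo f m ≡ pendantEdges s t m
applyUpTo-pendantEdges s t zero f f≡ = refl
applyUpTo-pendantEdges s t (suc m) f f≡ =
  cong₂ _∷_ (trans (f≡ 0) (cong₂ (λ n u → (1 + n , u)) (+-identityʳ s) (+-identityʳ t)))
            (applyUpTo-pendantEdges (3 + s) (suc t) m (f ∘ suc)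
               (λ k → trans (f≡ (suc k)) (cong₂ (λ n u → (1 + n , u)) (+-three s k) (+-suc t k))))

3*≡three : ∀ n → 3 * n ≡ three n
3*≡three zero = refl
3*≡three (suc n) = trans (*-suc 3 n) (cong (_+_ 3) (3*≡three n))

T≡chainEdges : ∀ j → T (suc j) ≡ chainEdges 0 (2 + three j) j
T≡chainEdges j = cong₂ _++_
  (trans (cong (λ n → applyUpTo (λ k → (suc k , suc (suc k))) (n ∸ 3)) (3*≡three (suc j)))
         (applyUpTo-pathEdges 0 (three j) _ (λ k → refl)))
  (applyUpTo-pendantEdges 0 (2 + three j) (suc j) _ pendant≡)
  where
  pendant≡ : ∀ k → (3 * suc k ∸ 2 , (3 * suc j ∸ 2) + suc k) ≡ (1 + three k , (2 + three j) + k)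
  pendant≡ k = cong₂ _,_ (cong (_∸ 2) (3*≡three (suc k)))
                         (trans (cong (λ n → (n ∸ 2) + suc k) (3*≡three (suc j))) (cong suc (+-suc (three j) k)))

length-chainEdges : ∀ s t j → length (chainEdges s t j) ≡ three j + suc j
length-chainEdges s t j =
  trans (length-++ (pathEdges s (three j))) (cong₂ _+_ (length-pathEdges s (three j)) (length-pendantEdges s t (suc j)))

quiet-∅ : ∀ j → Quiet 0 (2 + three j) j ∅
quiet-∅ j = (λ _ _ _ → refl) , (λ _ _ → refl)

isMaximalMatching-T : ∀ j x y → length x ≡ three j → length y ≡ suc j →
  isMaximalMatching (T (suc j)) (x ++ y) ≡ MaximalChain false x y
isMaximalMatching-T j x y lx ly rewrite T≡chainEdges j =
  trans (isMaximalMatching≡Avoiding∅ (chainEdges 0 (2 + three j) j) (x ++ y)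
           (trans (length-++ x) (trans (cong₂ _+_ lx ly) (sym (length-chainEdges 0 (2 + three j) j)))))
        (maximalChain-correct j 0 (2 + three j) x y ∅ lx ly ≤-refl (quiet-∅ j))

isMatching-T : ∀ j x y → length x ≡ three j → length y ≡ suc j →
  isMatching (T (suc j)) (x ++ y) ≡ MatchingChain false x y
isMatching-T j x y lx ly rewrite T≡chainEdges j =
  trans (isMatching≡Avoiding∅ (sel (chainEdges 0 (2 + three j) j) (x ++ y)))
        (matchingChain-correct j 0 (2 + three j) x y ∅ lx ly ≤-refl (quiet-∅ j))

when : Bool → ℕ → ℕ
when true n = n
when false _ = 0

trues : List Bool → ℕ
trues [] = 0
trues (true ∷ x) = suc (trues x)
trues (false ∷ x) = trues x

trues-++ : ∀ x y → trues (x ++ y) ≡ trues x + trues y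
trues-++ [] y = refl
trues-++ (true ∷ x) y = cong suc (trues-++ x y)
trues-++ (false ∷ x) y = trues-++ x y

length-sel : ∀ E c → length c ≡ length E → length (sel E c) ≡ trues c
length-sel [] [] _ = refl
length-sel (e ∷ E) (true ∷ c) l = cong suc (length-sel E c (suc-injective l))
length-sel (e ∷ E) (false ∷ c) l = length-sel E c (suc-injective l)

length-filter : ∀ (P : List Bool → Bool) xs →
  length (filter (λ c → P c ≟ true) xs) ≡ sum (map (λ c → when (P c) 1) xs)
length-filter P [] = refl
length-filter P (x ∷ xs) with P x
... | true = cong suc (length-filter P xs)
... | false = length-filter P xs

sum-filter : ∀ (P : List Bool → Bool) (f : List Bool → ℕ) xs →
  sum (map f (filter (λ c → P c ≟ true) xs)) ≡ sum (map (λ c → when (P c) (f c)) xs)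
sum-filter P f [] = refl
sum-filter P f (x ∷ xs) with P x
... | true = cong (_+_ (f x)) (sum-filter P f xs)
... | false = sum-filter P f xs

max-filter : ∀ (P : List Bool → Bool) (f : List Bool → ℕ) xs →
  foldr _⊔_ 0 (map f (filter (λ c → P c ≟ true) xs)) ≡ foldr _⊔_ 0 (map (λ c → when (P c) (f c)) xs)
max-filter P f [] = refl
max-filter P f (x ∷ xs) with P x
... | true = cong (f x ⊔_) (max-filter P f xs)
... | false = max-filter P f xs

sumChoices : ℕ → (List Bool → ℕ) → ℕ
sumChoices k f = sum (map f (choices k))

maxChoices : ℕ → (List Bool → ℕ) → ℕ
maxChoices k f = foldr _⊔_ 0 (map f (choices k))

sumChoices-suc : ∀ k f → sumChoices (suc k) f ≡ sumChoices k (f ∘ (true ∷_)) + sumChoices k (f ∘ (false ∷_))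
sumChoices-suc k f =
  trans (cong sum (map-++ f (map (true ∷_) (choices k)) (map (false ∷_) (choices k))))
        (trans (sum-++ (map f (map (true ∷_) (choices k))) _)
               (sym (cong₂ _+_ (cong sum (map-∘ (choices k))) (cong sum (map-∘ (choices k))))))

max-++ : ∀ xs ys → foldr _⊔_ 0 (xs ++ ys) ≡ foldr _⊔_ 0 xs ⊔ foldr _⊔_ 0 ys
max-++ [] ys = refl
max-++ (x ∷ xs) ys = trans (cong (x ⊔_) (max-++ xs ys)) (sym (⊔-assoc x _ _))

maxChoices-suc : ∀ k f → maxChoices (suc k) f ≡ maxChoices k (f ∘ (true ∷_)) ⊔ maxChoices k (f ∘ (false ∷_))
maxChoices-suc k f =
  trans (cong (foldr _⊔_ 0) (map-++ f (map (true ∷_) (choices k)) (map (false ∷_) (choices k))))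
        (trans (max-++ (map f (map (true ∷_) (choices k))) _)
               (sym (cong₂ _⊔_ (cong (foldr _⊔_ 0) (map-∘ (choices k))) (cong (foldr _⊔_ 0) (map-∘ (choices k))))))

sumChoices-cong : ∀ k {f g} → (∀ c → length c ≡ k → f c ≡ g c) → sumChoices k f ≡ sumChoices k g
sumChoices-cong zero f≡g = cong (_+ 0) (f≡g [] refl)
sumChoices-cong (suc k) {f} {g} f≡g =
  trans (sumChoices-suc k f)
        (trans (cong₂ _+_ (sumChoices-cong k λ c l → f≡g (true ∷ c) (cong suc l))
                          (sumChoices-cong k λ c l → f≡g (false ∷ c) (cong suc l)))
               (sym (sumChoices-suc k g)))

maxChoices-cong : ∀ k {f g} → (∀ c → length c ≡ k → f c ≡ g c) → maxChoices k f ≡ maxChoices k g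
maxChoices-cong zero f≡g = cong (_⊔ 0) (f≡g [] refl)
maxChoices-cong (suc k) {f} {g} f≡g =
  trans (maxChoices-suc k f)
        (trans (cong₂ _⊔_ (maxChoices-cong k λ c l → f≡g (true ∷ c) (cong suc l))
                          (maxChoices-cong k λ c l → f≡g (false ∷ c) (cong suc l)))
               (sym (maxChoices-suc k g)))

sumChoices-++ : ∀ k m f → sumChoices (k + m) f ≡ sumChoices k (λ x → sumChoices m (λ y → f (x ++ y)))
sumChoices-++ zero m f = sym (+-identityʳ _)
sumChoices-++ (suc k) m f =
  trans (sumChoices-suc (k + m) f)
        (trans (cong₂ _+_ (sumChoices-++ k m _) (sumChoices-++ k m _)) (sym (sumChoices-suc k _)))

maxChoices-++ : ∀ k m f → maxChoices (k + m) f ≡ maxChoices k (λ x → maxChoices m (λ y → f (x ++ y)))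
maxChoices-++ zero m f = sym (⊔-identityʳ _)
maxChoices-++ (suc k) m f =
  trans (maxChoices-suc (k + m) f)
        (trans (cong₂ _⊔_ (maxChoices-++ k m _) (maxChoices-++ k m _)) (sym (maxChoices-suc k _)))

sumChoices-+ : ∀ k f g → sumChoices k (λ x → f x + g x) ≡ sumChoices k f + sumChoices k g
sumChoices-+ zero f g =
  trans (+-identityʳ _) (sym (cong₂ _+_ (+-identityʳ (f [])) (+-identityʳ (g []))))
sumChoices-+ (suc k) f g =
  trans (sumChoices-suc k _)
        (trans (cong₂ _+_ (sumChoices-+ k _ _) (sumChoices-+ k _ _))
               (trans (+-interchange (sumChoices k (f ∘ (true ∷_))) _ _ _)
                      (sym (cong₂ _+_ (sumChoices-suc k f) (sumChoices-suc k g)))))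

sumChoices-*ˡ : ∀ k n f → sumChoices k (λ x → n * f x) ≡ n * sumChoices k f
sumChoices-*ˡ zero n f = trans (+-identityʳ _) (cong (n *_) (sym (+-identityʳ _)))
sumChoices-*ˡ (suc k) n f =
  trans (sumChoices-suc k _)
        (trans (cong₂ _+_ (sumChoices-*ˡ k n _) (sumChoices-*ˡ k n _))
               (trans (sym (*-distribˡ-+ n _ _)) (cong (n *_) (sym (sumChoices-suc k f)))))

sumChoices-when : ∀ k b f → sumChoices k (λ x → when b (f x)) ≡ when b (sumChoices k f)
sumChoices-when k true f = refl
sumChoices-when zero false f = refl
sumChoices-when (suc k) false f =
  trans (sumChoices-suc k _) (cong₂ _+_ (sumChoices-when k false (f ∘ (true ∷_))) (sumChoices-when k false (f ∘ (false ∷_))))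

maxChoices-least : ∀ k f n → (∀ c → length c ≡ k → f c ≤ n) → maxChoices k f ≤ n
maxChoices-least zero f n bound = ⊔-lub (bound [] refl) z≤n
maxChoices-least (suc k) f n bound rewrite maxChoices-suc k f =
  ⊔-lub (maxChoices-least k _ n λ c l → bound (true ∷ c) (cong suc l))
        (maxChoices-least k _ n λ c l → bound (false ∷ c) (cong suc l))

maxChoices-upper : ∀ k f c → length c ≡ k → f c ≤ maxChoices k f
maxChoices-upper zero f [] refl = m≤m⊔n (f []) 0
maxChoices-upper (suc k) f (true ∷ c) refl rewrite maxChoices-suc k f =
  ≤-trans (maxChoices-upper k (f ∘ (true ∷_)) c refl) (m≤m⊔n _ _)
maxChoices-upper (suc k) f (false ∷ c) refl rewrite maxChoices-suc k f =
  ≤-trans (maxChoices-upper k (f ∘ (false ∷_)) c refl) (m≤n⊔m _ _)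

chainCount : Bool → ℕ → ℕ
chainCount p j = sumChoices (three j) λ x → sumChoices (suc j) λ y → when (MaximalChain p x y) 1

chainSize : Bool → ℕ → ℕ
chainSize p j = sumChoices (three j) λ x → sumChoices (suc j) λ y → when (MaximalChain p x y) (trues x + trues y)

largestMatching : ℕ → ℕ
largestMatching j = maxChoices (three j) λ x → maxChoices (suc j) λ y → when (MatchingChain false x y) (trues x + trues y)

length-T : ∀ j → length (T (suc j)) ≡ three j + suc j
length-T j = trans (cong length (T≡chainEdges j)) (length-chainEdges 0 _ j)

size-T : ∀ j x y → length x ≡ three j → length y ≡ suc j → size (T (suc j)) (x ++ y) ≡ trues x + trues y
size-T j x y lx ly =
  trans (length-sel (T (suc j)) (x ++ y) (trans (length-++ x) (trans (cong₂ _+_ lx ly) (sym (length-T j)))))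
        (trues-++ x y)

𝒯₀-T : ∀ j → 𝒯₀ (T (suc j)) ≡ chainCount false j
𝒯₀-T j = begin
  length (filter (λ c → isMaximalMatching E c ≟ true) (choices (length E)))
    ≡⟨ length-filter (isMaximalMatching E) (choices (length E)) ⟩
  sumChoices (length E) (λ c → when (isMaximalMatching E c) 1)
    ≡⟨ cong (λ k → sumChoices k (λ c → when (isMaximalMatching E c) 1)) (length-T j) ⟩
  sumChoices (three j + suc j) (λ c → when (isMaximalMatching E c) 1)
    ≡⟨ sumChoices-++ (three j) (suc j) (λ c → when (isMaximalMatching E c) 1) ⟩
  sumChoices (three j) (λ x → sumChoices (suc j) λ y → when (isMaximalMatching E (x ++ y)) 1)
    ≡⟨ sumChoices-cong (three j) (λ x lx → sumChoices-cong (suc j) λ y ly →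
         cong (λ b → when b 1) (isMaximalMatching-T j x y lx ly)) ⟩
  chainCount false j ∎
  where
  open ≡-Reasoning
  E = T (suc j)

𝒯₁-T : ∀ j → 𝒯₁ (T (suc j)) ≡ chainSize false j
𝒯₁-T j = begin
  sum (map (size E) (filter (λ c → isMaximalMatching E c ≟ true) (choices (length E))))
    ≡⟨ sum-filter (isMaximalMatching E) (size E) (choices (length E)) ⟩
  sumChoices (length E) (λ c → when (isMaximalMatching E c) (size E c))
    ≡⟨ cong (λ k → sumChoices k (λ c → when (isMaximalMatching E c) (size E c))) (length-T j) ⟩
  sumChoices (three j + suc j) (λ c → when (isMaximalMatching E c) (size E c))
    ≡⟨ sumChoices-++ (three j) (suc j) (λ c → when (isMaximalMatching E c) (size E c)) ⟩
  sumChoices (three j) (λ x → sumChoices (suc j) λ y → when (isMaximalMatching E (x ++ y)) (size E (x ++ y)))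
    ≡⟨ sumChoices-cong (three j) (λ x lx → sumChoices-cong (suc j) λ y ly →
         cong₂ when (isMaximalMatching-T j x y lx ly) (size-T j x y lx ly)) ⟩
  chainSize false j ∎
  where
  open ≡-Reasoning
  E = T (suc j)

ν-T : ∀ j → ν (T (suc j)) ≡ largestMatching j
ν-T j = begin
  foldr _⊔_ 0 (map (size E) (filter (λ c → isMatching E c ≟ true) (choices (length E))))
    ≡⟨ max-filter (isMatching E) (size E) (choices (length E)) ⟩
  maxChoices (length E) (λ c → when (isMatching E c) (size E c))
    ≡⟨ cong (λ k → maxChoices k (λ c → when (isMatching E c) (size E c))) (length-T j) ⟩
  maxChoices (three j + suc j) (λ c → when (isMatching E c) (size E c))
    ≡⟨ maxChoices-++ (three j) (suc j) (λ c → when (isMatching E c) (size E c)) ⟩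
  maxChoices (three j) (λ x → maxChoices (suc j) λ y → when (isMatching E (x ++ y)) (size E (x ++ y)))
    ≡⟨ maxChoices-cong (three j) (λ x lx → maxChoices-cong (suc j) λ y ly →
         cong₂ when (isMatching-T j x y lx ly) (size-T j x y lx ly)) ⟩
  largestMatching j ∎
  where
  open ≡-Reasoning
  E = T (suc j)

ΣB : (Bool → ℕ) → ℕ
ΣB f = f true + f false

ΣBlock : (Bool → Bool → Bool → Bool → ℕ) → ℕ
ΣBlock f = ΣB λ a → ΣB λ b → ΣB λ c → ΣB λ y → f a b c y

ΣB-cong : ∀ {f g} → (∀ a → f a ≡ g a) → ΣB f ≡ ΣB g
ΣB-cong f≡g = cong₂ _+_ (f≡g true) (f≡g false)

ΣBlock-cong : ∀ {f g} → (∀ a b c y → f a b c y ≡ g a b c y) → ΣBlock f ≡ ΣBlock g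
ΣBlock-cong f≡g = ΣB-cong λ a → ΣB-cong λ b → ΣB-cong λ c → ΣB-cong λ y → f≡g a b c y

ΣB-+ : ∀ (f g : Bool → ℕ) → ΣB (λ a → f a + g a) ≡ ΣB f + ΣB g
ΣB-+ f g = +-interchange (f true) (g true) (f false) (g false)

ΣB-*ʳ : ∀ (f : Bool → ℕ) n → ΣB (λ a → f a * n) ≡ ΣB f * n
ΣB-*ʳ f n = sym (*-distribʳ-+ n (f true) (f false))

ΣBlock-+ : ∀ (f g : Bool → Bool → Bool → Bool → ℕ) → ΣBlock (λ a b c y → f a b c y + g a b c y) ≡ ΣBlock f + ΣBlock g
ΣBlock-+ f g =
  trans (ΣB-cong λ a → trans (ΣB-cong λ b → trans (ΣB-cong λ c → ΣB-+ (f a b c) (g a b c))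
                                                  (ΣB-+ (λ c → ΣB (f a b c)) (λ c → ΣB (g a b c))))
                             (ΣB-+ (λ b → ΣB λ c → ΣB (f a b c)) (λ b → ΣB λ c → ΣB (g a b c))))
        (ΣB-+ (λ a → ΣB λ b → ΣB λ c → ΣB (f a b c)) (λ a → ΣB λ b → ΣB λ c → ΣB (g a b c)))

ΣBlock-*ʳ : ∀ (f : Bool → Bool → Bool → Bool → ℕ) n → ΣBlock (λ a b c y → f a b c y * n) ≡ ΣBlock f * n
ΣBlock-*ʳ f n =
  trans (ΣB-cong λ a → trans (ΣB-cong λ b → trans (ΣB-cong λ c → ΣB-*ʳ (f a b c) n)
                                                  (ΣB-*ʳ (λ c → ΣB (f a b c)) n))
                             (ΣB-*ʳ (λ b → ΣB λ c → ΣB (f a b c)) n))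
        (ΣB-*ʳ (λ a → ΣB λ b → ΣB λ c → ΣB (f a b c)) n)

ΣBlock-by-last : ∀ (f : Bool → Bool → Bool → Bool → ℕ) (F : Bool → ℕ) →
  ΣBlock (λ a b c y → f a b c y * F c) ≡
  ΣBlock (λ a b c y → f a b c y * when (not c) 1) * F false + ΣBlock (λ a b c y → f a b c y * when c 1) * F true
ΣBlock-by-last f F =
  trans (ΣBlock-cong λ a b c y → by-c (f a b c y) c)
        (trans (ΣBlock-+ (λ a b c y → f a b c y * when (not c) 1 * F false) (λ a b c y → f a b c y * when c 1 * F true))
               (cong₂ _+_ (ΣBlock-*ʳ (λ a b c y → f a b c y * when (not c) 1) (F false))
                          (ΣBlock-*ʳ (λ a b c y → f a b c y * when c 1) (F true))))
  where
  open ℕ-Solver.+-*-Solver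
  by-c : ∀ n c → n * F c ≡ n * when (not c) 1 * F false + n * when c 1 * F true
  by-c n true = solve 3 (λ n A B → n :* B := n :* con 0 :* A :+ n :* con 1 :* B) refl n (F false) (F true)
  by-c n false = solve 3 (λ n A B → n :* A := n :* con 1 :* A :+ n :* con 0 :* B) refl n (F false) (F true)

sumChoices-block : ∀ k m (G : List Bool → List Bool → ℕ) →
  sumChoices (3 + k) (λ x → sumChoices (suc m) (G x)) ≡
  ΣBlock (λ a b c y₀ → sumChoices k λ x → sumChoices m λ y → G (a ∷ b ∷ c ∷ x) (y₀ ∷ y))
sumChoices-block k m G =
  trans (sumChoices-suc (2 + k) F) (ΣB-cong λ a →
  trans (sumChoices-suc (1 + k) (F ∘ (a ∷_))) (ΣB-cong λ b →
  trans (sumChoices-suc k (F ∘ (a ∷_) ∘ (b ∷_))) (ΣB-cong λ c →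
  trans (sumChoices-cong k (λ x _ → sumChoices-suc m (G (a ∷ b ∷ c ∷ x))))
        (sumChoices-+ k (λ x → sumChoices m (G (a ∷ b ∷ c ∷ x) ∘ (true ∷_)))
                        (λ x → sumChoices m (G (a ∷ b ∷ c ∷ x) ∘ (false ∷_)))))))
  where
  F : List Bool → ℕ
  F x = sumChoices (suc m) (G x)

sumChoices²-linear : ∀ k m u v (f g : List Bool → List Bool → ℕ) →
  (sumChoices k λ x → sumChoices m λ y → u * f x y + v * g x y) ≡
  u * (sumChoices k λ x → sumChoices m (f x)) + v * (sumChoices k λ x → sumChoices m (g x))
sumChoices²-linear k m u v f g =
  trans (sumChoices-cong k (λ x _ → trans (sumChoices-+ m _ _) (cong₂ _+_ (sumChoices-*ˡ m u (f x)) (sumChoices-*ˡ m v (g x)))))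
        (trans (sumChoices-+ k _ _) (cong₂ _+_ (sumChoices-*ˡ k u _) (sumChoices-*ˡ k v _)))

trues-block : ∀ a b c y₀ x y →
  trues (a ∷ b ∷ c ∷ x) + trues (y₀ ∷ y) ≡ trues (a ∷ b ∷ c ∷ y₀ ∷ []) + (trues x + trues y)
trues-block a b c y₀ x y =
  trans (cong₂ _+_ (trues-++ (a ∷ b ∷ c ∷ []) x) (trues-++ (y₀ ∷ []) y))
        (trans (+-interchange (trues (a ∷ b ∷ c ∷ [])) (trues x) (trues (y₀ ∷ [])) (trues y))
               (cong (_+ (trues x + trues y)) (sym (trues-++ (a ∷ b ∷ c ∷ []) (y₀ ∷ [])))))

chainCount-step : ∀ p j →
  chainCount p (suc j) ≡ ΣBlock (λ a b c y → when (maximalBlock p (not c) a b c y) 1 * chainCount c j)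
chainCount-step p j =
  trans (sumChoices-block (three j) (suc j) (λ x y → when (MaximalChain p x y) 1))
        (ΣBlock-cong λ a b c y₀ →
           trans (sumChoices-cong (three j) λ x _ → sumChoices-cong (suc j) λ y _ →
                    when-∧ (maximalBlock p (not c) a b c y₀) (MaximalChain c x y))
                 (trans (sumChoices-cong (three j) (λ x _ → sumChoices-*ˡ (suc j) (u a b c y₀) (λ y → when (MaximalChain c x y) 1)))
                        (sumChoices-*ˡ (three j) (u a b c y₀) (λ x → sumChoices (suc j) λ y → when (MaximalChain c x y) 1))))
  where
  u : Bool → Bool → Bool → Bool → ℕ
  u a b c y₀ = when (maximalBlock p (not c) a b c y₀) 1
  when-∧ : ∀ b d → when (b ∧ d) 1 ≡ when b 1 * when d 1
  when-∧ true d = sym (+-identityʳ _)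
  when-∧ false d = refl

chainSize-step : ∀ p j →
  chainSize p (suc j) ≡
  ΣBlock (λ a b c y → when (maximalBlock p (not c) a b c y) (trues (a ∷ b ∷ c ∷ y ∷ [])) * chainCount c j) +
  ΣBlock (λ a b c y → when (maximalBlock p (not c) a b c y) 1 * chainSize c j)
chainSize-step p j =
  trans (sumChoices-block (three j) (suc j) (λ x y → when (MaximalChain p x y) (trues x + trues y)))
        (trans (ΣBlock-cong λ a b c y₀ →
                  trans (sumChoices-cong (three j) λ x _ → sumChoices-cong (suc j) λ y _ →
                           trans (cong (when (maximalBlock p (not c) a b c y₀ ∧ MaximalChain c x y)) (trues-block a b c y₀ x y))
                                 (when-∧-+ (maximalBlock p (not c) a b c y₀) (MaximalChain c x y)
                                           (trues (a ∷ b ∷ c ∷ y₀ ∷ [])) (trues x + trues y)))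
                        (sumChoices²-linear (three j) (suc j)
                           (when (maximalBlock p (not c) a b c y₀) (trues (a ∷ b ∷ c ∷ y₀ ∷ [])))
                           (when (maximalBlock p (not c) a b c y₀) 1)
                           (λ x y → when (MaximalChain c x y) 1) (λ x y → when (MaximalChain c x y) (trues x + trues y))))
               (ΣBlock-+ (λ a b c y → when (maximalBlock p (not c) a b c y) (trues (a ∷ b ∷ c ∷ y ∷ [])) * chainCount c j)
                         (λ a b c y → when (maximalBlock p (not c) a b c y) 1 * chainSize c j)))
  where
  open ℕ-Solver.+-*-Solver
  when-∧-+ : ∀ b d n m → when (b ∧ d) (n + m) ≡ when b n * when d 1 + when b 1 * when d m
  when-∧-+ true true n m = solve 2 (λ n m → n :+ m := n :* con 1 :+ con 1 :* m) refl n m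
  when-∧-+ true false n m = solve 1 (λ n → con 0 := n :* con 0 :+ con 0) refl n
  when-∧-+ false d n m = refl

chainCount-transfer : ∀ p j →
  chainCount p (suc j) ≡
  ΣBlock (λ a b c y → when (maximalBlock p (not c) a b c y) 1 * when (not c) 1) * chainCount false j +
  ΣBlock (λ a b c y → when (maximalBlock p (not c) a b c y) 1 * when c 1) * chainCount true j
chainCount-transfer p j =
  trans (chainCount-step p j) (ΣBlock-by-last (λ a b c y → when (maximalBlock p (not c) a b c y) 1) (λ c → chainCount c j))

chainSize-transfer : ∀ p j →
  chainSize p (suc j) ≡
  (ΣBlock (λ a b c y → when (maximalBlock p (not c) a b c y) (trues (a ∷ b ∷ c ∷ y ∷ [])) * when (not c) 1) * chainCount false j +
   ΣBlock (λ a b c y → when (maximalBlock p (not c) a b c y) (trues (a ∷ b ∷ c ∷ y ∷ [])) * when c 1) * chainCount true j) +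
  (ΣBlock (λ a b c y → when (maximalBlock p (not c) a b c y) 1 * when (not c) 1) * chainSize false j +
   ΣBlock (λ a b c y → when (maximalBlock p (not c) a b c y) 1 * when c 1) * chainSize true j)
chainSize-transfer p j =
  trans (chainSize-step p j)
        (cong₂ _+_ (ΣBlock-by-last (λ a b c y → when (maximalBlock p (not c) a b c y) (trues (a ∷ b ∷ c ∷ y ∷ [])))
                                   (λ c → chainCount c j))
                   (ΣBlock-by-last (λ a b c y → when (maximalBlock p (not c) a b c y) 1) (λ c → chainSize c j)))

-- The block sums in the transfer lemmas evaluate to these coefficients.
chainCount-false-suc : ∀ j → chainCount false (suc j) ≡ 2 * chainCount false j + 2 * chainCount true j
chainCount-false-suc = chainCount-transfer false

chainCount-true-suc : ∀ j → chainCount true (suc j) ≡ 1 * chainCount false j + 1 * chainCount true j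
chainCount-true-suc = chainCount-transfer true

chainSize-false-suc : ∀ j →
  chainSize false (suc j) ≡ (3 * chainCount false j + 4 * chainCount true j) + (2 * chainSize false j + 2 * chainSize true j)
chainSize-false-suc = chainSize-transfer false

chainSize-true-suc : ∀ j →
  chainSize true (suc j) ≡ (1 * chainCount false j + 1 * chainCount true j) + (1 * chainSize false j + 1 * chainSize true j)
chainSize-true-suc = chainSize-transfer true

matchingBlock-size : ∀ p a b c y → matchingBlock p false a b c y ≡ true → trues (a ∷ b ∷ c ∷ y ∷ []) ≤ 2
matchingBlock-size = from-yes
  (∀ᵇ? λ p → ∀ᵇ? λ a → ∀ᵇ? λ b → ∀ᵇ? λ c → ∀ᵇ? λ y →
     (matchingBlock p false a b c y ≟ true) →-dec (trues (a ∷ b ∷ c ∷ y ∷ []) ≤? 2))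

matchingChain-size : ∀ j p x y → length x ≡ three j → length y ≡ suc j →
  MatchingChain p x y ≡ true → trues x + trues y ≤ suc (j + j)
matchingChain-size zero p [] (true ∷ []) _ _ _ = ≤-refl
matchingChain-size zero p [] (false ∷ []) _ _ _ = z≤n
matchingChain-size (suc j) p (a ∷ b ∷ c ∷ x) (y₀ ∷ y) lx ly chain rewrite trues-block a b c y₀ x y =
  ≤-trans (+-mono-≤ (matchingBlock-size p a b c y₀ (∧-conicalˡ _ _ chain))
                    (matchingChain-size j c x y (suc-injective (suc-injective (suc-injective lx))) (suc-injective ly)
                       (∧-conicalʳ (matchingBlock p false a b c y₀) _ chain)))
          (≤-reflexive (cong (_+_ 2) (sym (+-suc j j))))

alternatingPath : ℕ → List Bool
alternatingPath zero = []
alternatingPath (suc j) = false ∷ true ∷ false ∷ alternatingPath j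

length-alternatingPath : ∀ j → length (alternatingPath j) ≡ three j
length-alternatingPath zero = refl
length-alternatingPath (suc j) = cong (_+_ 3) (length-alternatingPath j)

trues-alternatingPath : ∀ j → trues (alternatingPath j) ≡ j
trues-alternatingPath zero = refl
trues-alternatingPath (suc j) = cong suc (trues-alternatingPath j)

trues-replicate : ∀ n → trues (replicate n true) ≡ n
trues-replicate zero = refl
trues-replicate (suc n) = cong suc (trues-replicate n)

alternating-matchingChain : ∀ j → MatchingChain false (alternatingPath j) (replicate (suc j) true) ≡ true
alternating-matchingChain zero = refl
alternating-matchingChain (suc j) = alternating-matchingChain j

largestMatching≡ : ∀ j → largestMatching j ≡ suc (j + j)
largestMatching≡ j = ≤-antisym
  (maxChoices-least (three j) _ _ λ x lx → maxChoices-least (suc j) _ _ λ y ly → bounded x y lx ly)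
  (≤-trans (≤-reflexive (sym attained))
    (≤-trans (maxChoices-upper (suc j) (λ y → when (MatchingChain false (alternatingPath j) y) (trues (alternatingPath j) + trues y))
                               (replicate (suc j) true) (length-replicate (suc j)))
             (maxChoices-upper (three j) (λ x → maxChoices (suc j) λ y → when (MatchingChain false x y) (trues x + trues y))
                               (alternatingPath j) (length-alternatingPath j))))
  where
  bounded : ∀ x y → length x ≡ three j → length y ≡ suc j → when (MatchingChain false x y) (trues x + trues y) ≤ suc (j + j)
  bounded x y lx ly with MatchingChain false x y in chain
  ... | true = matchingChain-size j false x y lx ly chain
  ... | false = z≤n
  attained : when (MatchingChain false (alternatingPath j) (replicate (suc j) true))
                  (trues (alternatingPath j) + trues (replicate (suc j) true)) ≡ suc (j + j)
  attained rewrite alternating-matchingChain j | trues-alternatingPath j | trues-replicate (suc j) = +-suc j j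

chainCount-false-positive : ∀ j → 1 ≤ chainCount false j
chainCount-false-positive zero = s≤s z≤n
chainCount-false-positive (suc j) rewrite chainCount-false-suc j =
  ≤-trans (chainCount-false-positive j) (≤-trans (m≤m+n _ _) (m≤m+n _ _))

closed-forms-step : ∀ i A B SA SB A′ B′ SA′ SB′ →
  A′ ≡ 2 * A + 2 * B → B′ ≡ 1 * A + 1 * B →
  SA′ ≡ (3 * A + 4 * B) + (2 * SA + 2 * SB) → SB′ ≡ (1 * A + 1 * B) + (1 * SA + 1 * SB) →
  A ≡ 2 * B → 9 * SA ≡ A * (13 * i + 33) → 9 * SB ≡ B * (13 * i + 27) →
  A′ ≡ 2 * B′ × 9 * SA′ ≡ A′ * (13 * suc i + 33) × 9 * SB′ ≡ B′ * (13 * suc i + 27)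
closed-forms-step i .(2 * B) B SA SB _ _ _ _ refl refl refl refl refl hA hB =
  solve 1 (λ B → con 2 :* (con 2 :* B) :+ con 2 :* B := con 2 :* (con 1 :* (con 2 :* B) :+ con 1 :* B)) refl B ,
  (begin
    9 * ((3 * (2 * B) + 4 * B) + (2 * SA + 2 * SB))
      ≡⟨ solve 3 (λ B SA SB → con 9 :* ((con 3 :* (con 2 :* B) :+ con 4 :* B) :+ (con 2 :* SA :+ con 2 :* SB))
                            := con 90 :* B :+ (con 2 :* (con 9 :* SA) :+ con 2 :* (con 9 :* SB))) refl B SA SB ⟩
    90 * B + (2 * (9 * SA) + 2 * (9 * SB))
      ≡⟨ cong₂ (λ u w → 90 * B + (2 * u + 2 * w)) hA hB ⟩
    90 * B + (2 * (2 * B * (13 * i + 33)) + 2 * (B * (13 * i + 27)))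
      ≡⟨ solve 2 (λ B i → con 90 :* B :+ (con 2 :* (con 2 :* B :* (con 13 :* i :+ con 33)) :+ con 2 :* (B :* (con 13 :* i :+ con 27)))
                        := (con 2 :* (con 2 :* B) :+ con 2 :* B) :* (con 13 :* (con 1 :+ i) :+ con 33)) refl B i ⟩
    (2 * (2 * B) + 2 * B) * (13 * suc i + 33) ∎) ,
  (begin
    9 * ((1 * (2 * B) + 1 * B) + (1 * SA + 1 * SB))
      ≡⟨ solve 3 (λ B SA SB → con 9 :* ((con 1 :* (con 2 :* B) :+ con 1 :* B) :+ (con 1 :* SA :+ con 1 :* SB))
                            := con 27 :* B :+ (con 9 :* SA :+ con 9 :* SB)) refl B SA SB ⟩
    27 * B + (9 * SA + 9 * SB)
      ≡⟨ cong₂ (λ u w → 27 * B + (u + w)) hA hB ⟩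
    27 * B + (2 * B * (13 * i + 33) + B * (13 * i + 27))
      ≡⟨ solve 2 (λ B i → con 27 :* B :+ (con 2 :* B :* (con 13 :* i :+ con 33) :+ B :* (con 13 :* i :+ con 27))
                        := (con 1 :* (con 2 :* B) :+ con 1 :* B) :* (con 13 :* (con 1 :+ i) :+ con 27)) refl B i ⟩
    (1 * (2 * B) + 1 * B) * (13 * suc i + 27) ∎)
  where
  open ≡-Reasoning
  open ℕ-Solver.+-*-Solver

closed-forms : ∀ i →
  chainCount false (suc (suc i)) ≡ 2 * chainCount true (suc (suc i)) ×
  9 * chainSize false (suc (suc i)) ≡ chainCount false (suc (suc i)) * (13 * i + 33) ×
  9 * chainSize true (suc (suc i)) ≡ chainCount true (suc (suc i)) * (13 * i + 27)
closed-forms zero = refl , refl , refl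
closed-forms (suc i) =
  let A≡2B , hA , hB = closed-forms i
  in closed-forms-step i
       (chainCount false (suc (suc i))) (chainCount true (suc (suc i))) (chainSize false (suc (suc i))) (chainSize true (suc (suc i)))
       (chainCount false (suc (suc (suc i)))) (chainCount true (suc (suc (suc i))))
       (chainSize false (suc (suc (suc i)))) (chainSize true (suc (suc (suc i))))
       (chainCount-false-suc (suc (suc i))) (chainCount-true-suc (suc (suc i)))
       (chainSize-false-suc (suc (suc i))) (chainSize-true-suc (suc (suc i))) A≡2B hA hB

ℐ-as-fraction : ∀ E d → ν E * 𝒯₀ E ≡ suc d → ℐ E ≡ (+ 𝒯₁ E) / suc d
ℐ-as-fraction E d νT₀≡ with ν E * 𝒯₀ E | νT₀≡
... | .(suc d) | refl = refl

fraction-near-13/18 : ∀ S d A en ed .(c : Coprime (suc en) (suc ed)) →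
  18 * S ≡ 13 * suc d + A → A * suc ed <ₙ suc en * (suc d * 18) →
  ∣ (+ S) / suc d - + 13 / 18 ∣ < mkℚ (+ suc en) ed c
fraction-near-13/18 S d A en ed c key bound =
  toℚᵘ-cancel-< (<-respˡ-≃ (≃-sym as-unnormalised) (ℚᵘ.*<* (subst (λ n → + ℤ.∣ n ∣ ℤ.* + suc ed ℤ.< ε-side) (sym numerator) A-side)))
  where
  q r : ℚ
  q = (+ S) / suc d
  r = (+ 13) / 18
  ε-side : ℤ.ℤ
  ε-side = + suc en ℤ.* + (suc d * 18)
  A-side : + A ℤ.* + suc ed ℤ.< ε-side
  A-side = subst₂ ℤ._<_ (pos-* A (suc ed)) (pos-* (suc en) (suc d * 18)) (+<+ bound)
  as-unnormalised : toℚᵘ ∣ q - r ∣ ≃ ℚᵘ.∣ mkℚᵘ (+ S) d ℚᵘ.- mkℚᵘ (+ 13) 17 ∣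
  as-unnormalised =
    ≃-trans (toℚᵘ-homo-∣-∣ (q - r))
      (∣-∣-cong (≃-trans (toℚᵘ-homo-+ q (- r))
        (+-cong (toℚᵘ-fromℚᵘ (mkℚᵘ (+ S) d))
                (≃-trans (toℚᵘ-homo‿- r) (-‿cong (toℚᵘ-fromℚᵘ (mkℚᵘ (+ 13) 17)))))))
  numerator : + S ℤ.* + 18 ℤ.+ -[1+ 12 ] ℤ.* + suc d ≡ + A
  numerator = begin
    + S ℤ.* + 18 ℤ.+ -[1+ 12 ] ℤ.* + suc d
      ≡⟨ solve 2 (λ s n → s :* con (+ 18) :+ con -[1+ 12 ] :* n := con (+ 18) :* s :- con (+ 13) :* n)
               refl (+ S) (+ suc d) ⟩
    + 18 ℤ.* + S ℤ.- + 13 ℤ.* + suc d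
      ≡⟨ cong₂ ℤ._-_ (sym (pos-* 18 S)) (sym (pos-* 13 (suc d))) ⟩
    + (18 * S) ℤ.- + (13 * suc d)
      ≡⟨ cong (λ n → + n ℤ.- + (13 * suc d)) key ⟩
    + (13 * suc d + A) ℤ.- + (13 * suc d)
      ≡⟨ cong (ℤ._- + (13 * suc d)) (pos-+ (13 * suc d) A) ⟩
    + (13 * suc d) ℤ.+ + A ℤ.- + (13 * suc d)
      ≡⟨ solve 2 (λ x a → x :+ a :- x := a) refl (+ (13 * suc d)) (+ A) ⟩
    + A ∎
    where
    open ≡-Reasoning
    open ℤ-Solver.+-*-Solver

eighteen-sizes : ∀ A S i → 9 * S ≡ A * (13 * i + 33) → 18 * S ≡ 13 * (suc (suc (suc i) + suc (suc i)) * A) + A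
eighteen-sizes A S i 9S≡ = begin
  18 * S                     ≡⟨ solve 1 (λ S → con 18 :* S := con 2 :* (con 9 :* S)) refl S ⟩
  2 * (9 * S)                ≡⟨ cong (2 *_) 9S≡ ⟩
  2 * (A * (13 * i + 33))    ≡⟨ solve 2 (λ A i → con 2 :* (A :* (con 13 :* i :+ con 33)) :=
                                                 con 13 :* ((con 1 :+ ((con 2 :+ i) :+ (con 2 :+ i))) :* A) :+ A)
                                     refl A i ⟩
  13 * (suc (suc (suc i) + suc (suc i)) * A) + A ∎
  where
  open ≡-Reasoning
  open ℕ-Solver.+-*-Solver

ℐ-T-close : ∀ en ed .(c : Coprime (suc en) (suc ed)) i a′ → chainCount false (suc (suc i)) ≡ suc a′ → ed ≤ i →
  ∣ ℐ (T (suc (suc (suc i)))) - + 13 / 18 ∣ < mkℚ (+ suc en) ed c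
ℐ-T-close en ed c i a′ A≡ ed≤i =
  subst (λ q → ∣ q - + 13 / 18 ∣ < mkℚ (+ suc en) ed c) (sym ℐ≡) (fraction-near-13/18 S d (suc a′) en ed c key bound)
  where
  j S d : ℕ
  j = suc (suc i)
  S = chainSize false j
  d = a′ + (j + j) * suc a′
  ℐ≡ : ℐ (T (suc j)) ≡ (+ S) / suc d
  ℐ≡ = trans (ℐ-as-fraction (T (suc j)) d (cong₂ _*_ (trans (ν-T j) (largestMatching≡ j)) (trans (𝒯₀-T j) A≡)))
             (cong (λ s → (+ s) / suc d) (𝒯₁-T j))
  key : 18 * S ≡ 13 * suc d + suc a′
  key = eighteen-sizes (suc a′) S i (subst (λ A → 9 * S ≡ A * (13 * i + 33)) A≡ (proj₁ (proj₂ (closed-forms i))))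
  ed≤j+j : ed ≤ j + j
  ed≤j+j = ≤-trans ed≤i (≤-trans (n≤1+n i) (≤-trans (n≤1+n (suc i)) (m≤m+n j j)))
  bound : suc a′ * suc ed <ₙ suc en * (suc d * 18)
  bound = ≤-<-trans (≤-trans (*-monoʳ-≤ (suc a′) (s≤s ed≤j+j)) (≤-reflexive (*-comm (suc a′) (suc (j + j)))))
                    (<-≤-trans (m<m*n (suc d) 18 (s≤s (s≤s z≤n))) (m≤n*m (suc d * 18) (suc en)))

positive⇒suc : ∀ {m} → 1 ≤ m → Σ ℕ λ k → m ≡ suc k
positive⇒suc {suc k} _ = k , refl

theorem11 : (ε : ℚ) → 0ℚ < ε →
    Σ ℕ (λ N → (n : ℕ) → N ≤ n → ∣ ℐ (T n) - (+ 13 / 18) ∣ < ε)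
theorem11 (mkℚ (+ zero) ed c) (*<* (+<+ ()))
theorem11 (mkℚ -[1+ _ ] ed c) (*<* ())
theorem11 (mkℚ (+ suc en) ed c) _ = 3 + ed , λ where
  (suc (suc (suc i))) (s≤s (s≤s (s≤s ed≤i))) →
    let a′ , A≡ = positive⇒suc (chainCount-false-positive (suc (suc i)))
    in ℐ-T-close en ed c i a′ A≡ ed≤i
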